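{- Let $\Phi=(A;\{E_i\}_{i=0}^d;A^*;\{E^*_i\}_{i=0}^d)$ be a pre Leonard system on $V$ with eigenvalue sequence $\{\theta_i\}_{i=0}^d$ and dual eigenvalue sequence $\{\theta^*_i\}_{i=0}^d$. The following are equivalent: (i) for $0\le i,j\le d$: $E^*_iAE^*_j=0$ if $i-j>1$ and $E^*_iAE^*_j\neq0$ if $i-j=1$; and $E_iA^*E_j=0$ if $j-i>1$; (ii) there exists a decomposition $\{U_i\}_{i=0}^d$ of $V$ such that $(A-\theta_iI)U_i=U_{i+1}$ for $0\le i\le d-1$, $(A-\theta_dI)U_d=0$, $(A^*-\theta^*_iI)U_i\subseteq U_{i-1}$ for $1\le i\le d$, and $(A^*-\theta^*_0I)U_0=0$; (iii) there exist scalars $\varphi_1,\dots,\varphi_d\in\mathbb F$ and a basis of $V$ with respect to which $A$ is represented by the lower bidiagonal matrix with diagonal entries $\theta_0,\dots,\theta_d$ and all subdiagonal entries $1$, and $A^*$ is represented by the upper bidiagonal matrix with diagonal entries $\theta^*_0,\dots,\theta^*_d$ and superdiagonal entries $\varphi_1,\dots,\varphi_d$. Moreover, if (i)–(iii) hold, then $E^*_0$ is normalizing; the decomposition in (ii) satisfies $U_i=\tau_i(A)E^*_0V$ for $0\le i\le d$; the basis in (iii) is $\{\tau_i(A)\xi\}_{i=0}^d$ for some $0\neq\xi\in E^*_0V$, and this basis induces the decomposition $\{U_i\}_{i=0}^d$; and the sequence $\{\varphi_i\}_{i=1}^d$ in (iii) is unique.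
   Context: Let $\mathbb F$ be a field, $d\ge0$ an integer, $V$ an $\mathbb F$-vector space of dimension $d+1$. A matrix $M$ represents $X\in{\rm End}(V)$ with respect to a basis $\{v_i\}$ if $Xv_j=\sum_i M_{ij}v_i$. An element $A\in{\rm End}(V)$ is multiplicity-free if it has $d+1$ mutually distinct eigenvalues in $\mathbb F$; its primitive idempotent for an eigenvalue $\theta$ is the projection onto the $\theta$-eigenspace along the sum of the other eigenspaces. A pre Leonard system on $V$ is a sequence $(A;\{E_i\}_{i=0}^d;A^*;\{E^*_i\}_{i=0}^d)$ of elements of ${\rm End}(V)$ ($A^*$ is a second arbitrary element, not an adjoint) such that $A,A^*$ are multiplicity-free, $E_0,\dots,E_d$ is an ordering of the primitive idempotents of $A$ and $E^*_0,\dots,E^*_d$ is an ordering of the primitive idempotents of $A^*$. Its eigenvalue sequence is $\{\theta_i\}$ with $AE_i=\theta_iE_i$, and its dual eigenvalue sequence is $\{\theta^*_i\}$ with $A^*E^*_i=\theta^*_iE^*_i$. $E^*_0$ is normalizing if $E_iE^*_0\ne0$ for all $i$. A decomposition of $V$ is a sequence $\{V_i\}_{i=0}^d$ of one-dimensional subspaces with $V=\sum_iV_i$ direct; a basis $\{v_i\}$ induces the decomposition $\{{\rm span}(v_i)\}$. For $0\le i\le d$, $\tau_i=(\lambda-\theta_0)(\lambda-\theta_1)\cdots(\lambda-\theta_{i-1})\in\mathbb F[\lambda]$. -}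

module Defs where

open import Level using (Level; _⊔_) renaming (suc to lsuc)
open import Algebra.Bundles using (CommutativeRing)
open import Data.Nat as ℕ using (ℕ; zero; suc; _<_)
open import Data.Fin as Fin using (Fin; zero; suc; toℕ; inject₁; fromℕ)
open import Data.Product using (Σ; _×_; _,_)
open import Relation.Nullary using (¬_; yes; no)
open import Relation.Binary.PropositionalEquality using (_≡_)

record Field (c ℓ : Level) : Set (lsuc (c ⊔ ℓ)) where
  field
    commutativeRing : CommutativeRing c ℓ
  open CommutativeRing commutativeRing public
  field
    1≉0 : ¬ (1# ≈ 0#)
    inverse : ∀ x → ¬ (x ≈ 0#) → Σ Carrier (λ y → (x * y) ≈ 1#)

-- Linear algebra on V = F^(d+1); endomorphisms are (d+1)×(d+1) matrices,
-- acting on column vectors:  (M v) i = Σ_j M i j * v j.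
module LinAlg {c ℓ : Level} (F : Field c ℓ) (d : ℕ) where
  open Field F using (Carrier; _≈_; _+_; _*_; -_; 0#; 1#)

  L : Level
  L = c ⊔ ℓ

  n : ℕ
  n = suc d

  sumF : ∀ {m} → (Fin m → Carrier) → Carrier
  sumF {zero}  f = 0#
  sumF {suc m} f = f zero + sumF (λ k → f (suc k))

  Vec : Set c
  Vec = Fin n → Carrier

  Mat : Set c
  Mat = Fin n → Fin n → Carrier

  _≈ᵥ_ : Vec → Vec → Set ℓ
  u ≈ᵥ v = ∀ i → u i ≈ v i

  _≈ₘ_ : Mat → Mat → Set ℓ
  M ≈ₘ N = ∀ i j → M i j ≈ N i j

  0ᵥ : Vec
  0ᵥ i = 0#

  _+ᵥ_ : Vec → Vec → Vec
  (u +ᵥ v) i = u i + v i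

  _-ᵥ_ : Vec → Vec → Vec
  (u -ᵥ v) i = u i + (- v i)

  _•_ : Carrier → Vec → Vec
  (a • v) i = a * v i

  vsum : ∀ {m} → (Fin m → Vec) → Vec
  vsum u i = sumF (λ k → u k i)

  0ₘ : Mat
  0ₘ i j = 0#

  Iₘ : Mat
  Iₘ i j with i Fin.≟ j
  ... | yes _ = 1#
  ... | no _  = 0#

  _*ₘ_ : Mat → Mat → Mat
  (M *ₘ N) i j = sumF (λ k → M i k * N k j)

  _-ₘ_ : Mat → Mat → Mat
  (M -ₘ N) i j = M i j + (- N i j)

  _•ₘ_ : Carrier → Mat → Mat
  (a •ₘ M) i j = a * M i j

  shift : Mat → Carrier → Mat
  shift X a = X -ₘ (a •ₘ Iₘ)

  _·_ : Mat → Vec → Vec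
  (M · v) i = sumF (λ j → M i j * v j)

  IsEigenvalue : Mat → Carrier → Set L
  IsEigenvalue A θ = Σ Vec (λ v → ¬ (v ≈ᵥ 0ᵥ) × ((A · v) ≈ᵥ (θ • v)))

  InEigenspace : Mat → Carrier → Vec → Set ℓ
  InEigenspace A θ v = (A · v) ≈ᵥ (θ • v)

  InOtherEigenspaces : Mat → Carrier → Vec → Set L
  InOtherEigenspaces A θ w =
    Σ ℕ (λ m → Σ (Fin m → Carrier) (λ μ → Σ (Fin m → Vec) (λ u →
      (∀ k → ¬ (μ k ≈ θ)) × (∀ k → InEigenspace A (μ k) (u k)) × (w ≈ᵥ vsum u))))

  MultiplicityFree : Mat → Set L
  MultiplicityFree A = Σ (Fin n → Carrier) (λ λs →
    (∀ i j → ¬ (i ≡ j) → ¬ (λs i ≈ λs j)) × (∀ i → IsEigenvalue A (λs i)))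

  -- E is the projection onto the θ-eigenspace along the sum of the other eigenspaces
  IsPrimitiveIdempotentFor : Mat → Carrier → Mat → Set L
  IsPrimitiveIdempotentFor A θ E =
    IsEigenvalue A θ × (∀ v → InEigenspace A θ (E · v))
                     × (∀ v → InOtherEigenspaces A θ (v -ᵥ (E · v)))

  IsPrimitiveIdempotent : Mat → Mat → Set L
  IsPrimitiveIdempotent A E = Σ Carrier (λ θ → IsPrimitiveIdempotentFor A θ E)

  IsOrdering : Mat → (Fin n → Mat) → Set L
  IsOrdering A E = (∀ i → IsPrimitiveIdempotent A (E i))
                 × (∀ i j → ¬ (i ≡ j) → ¬ (E i ≈ₘ E j))
                 × (∀ E' → IsPrimitiveIdempotent A E' → Σ (Fin n) (λ i → E' ≈ₘ E i))

  IsPreLeonardSystem : Mat → (Fin n → Mat) → Mat → (Fin n → Mat)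
                     → (Fin n → Carrier) → (Fin n → Carrier) → Set L
  IsPreLeonardSystem A E As Es θ θs =
    MultiplicityFree A × MultiplicityFree As × IsOrdering A E × IsOrdering As Es
    × (∀ i → (A *ₘ E i) ≈ₘ (θ i •ₘ E i)) × (∀ i → (As *ₘ Es i) ≈ₘ (θs i •ₘ Es i))

  Subspace : Set (lsuc L)
  Subspace = Vec → Set L

  span1 : Vec → Subspace
  span1 u w = Σ Carrier (λ a → w ≈ᵥ (a • u))

  ZeroSub : Subspace
  ZeroSub w = Level.Lift L (w ≈ᵥ 0ᵥ)

  _⊆_ : Subspace → Subspace → Set L
  U ⊆ W = ∀ w → U w → W w

  _≐_ : Subspace → Subspace → Set L
  U ≐ W = (U ⊆ W) × (W ⊆ U)

  Image : Mat → Subspace → Subspace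
  Image X U w = Σ Vec (λ v → U v × (w ≈ᵥ (X · v)))

  Range : Mat → Subspace
  Range X w = Σ Vec (λ v → w ≈ᵥ (X · v))

  OneDimensional : Subspace → Set L
  OneDimensional U = Σ Vec (λ u → ¬ (u ≈ᵥ 0ᵥ) × (U ≐ span1 u))

  IsDecomposition : (Fin n → Subspace) → Set L
  IsDecomposition U =
    (∀ i → OneDimensional (U i))
    × (∀ v → Σ (Fin n → Vec) (λ u → (∀ i → U i (u i)) × (v ≈ᵥ vsum u)))
    × (∀ u u' → (∀ i → U i (u i)) → (∀ i → U i (u' i))
         → vsum u ≈ᵥ vsum u' → ∀ i → u i ≈ᵥ u' i)

  IsBasis : (Fin n → Vec) → Set L
  IsBasis b =
    (∀ (a : Fin n → Carrier) → vsum (λ i → a i • b i) ≈ᵥ 0ᵥ → ∀ i → a i ≈ 0#)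
    × (∀ v → Σ (Fin n → Carrier) (λ a → v ≈ᵥ vsum (λ i → a i • b i)))

  Represents : Mat → Mat → (Fin n → Vec) → Set ℓ
  Represents M X b = ∀ j → (X · b j) ≈ᵥ vsum (λ i → M i j • b i)

  lowerBidiag : (Fin n → Carrier) → Mat
  lowerBidiag θ i j with i Fin.≟ j | toℕ i ℕ.≟ suc (toℕ j)
  ... | yes _ | _     = θ i
  ... | no _  | yes _ = 1#
  ... | no _  | no _  = 0#

  -- upper bidiagonal: diagonal θ*₀..θ*_d, superdiagonal φ₁..φ_d
  -- (φ k stands for φ_{k+1}, placed in row k, column k+1)
  upperBidiag : (Fin n → Carrier) → (Fin d → Carrier) → Mat
  upperBidiag θs φ i zero with i Fin.≟ zero
  ... | yes _ = θs zero
  ... | no _  = 0#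
  upperBidiag θs φ i (suc k) with i Fin.≟ suc k | toℕ i ℕ.≟ toℕ k
  ... | yes _ | _     = θs (suc k)
  ... | no _  | yes _ = φ k
  ... | no _  | no _  = 0#

  -- τ_i(A) = (A − θ₀I)(A − θ₁I)⋯(A − θ_{i−1}I)
  tauGen : ∀ {m} → (Fin m → Carrier) → Mat → Fin (suc m) → Mat
  tauGen θ A zero = Iₘ
  tauGen {suc m} θ A (suc i) = shift A (θ zero) *ₘ tauGen (λ k → θ (suc k)) A i

  tau : (Fin n → Carrier) → Mat → Fin n → Mat
  tau θ A i = tauGen θ A (inject₁ i)

  CondI : Mat → (Fin n → Mat) → Mat → (Fin n → Mat) → Set ℓ
  CondI A E As Es =
    (∀ i j → suc (toℕ j) < toℕ i → ((Es i *ₘ A) *ₘ Es j) ≈ₘ 0ₘ)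
    × (∀ i j → toℕ i ≡ suc (toℕ j) → ¬ (((Es i *ₘ A) *ₘ Es j) ≈ₘ 0ₘ))
    × (∀ i j → suc (toℕ i) < toℕ j → ((E i *ₘ As) *ₘ E j) ≈ₘ 0ₘ)

  CondIIFor : Mat → Mat → (Fin n → Carrier) → (Fin n → Carrier) → (Fin n → Subspace) → Set L
  CondIIFor A As θ θs U =
    (∀ (i : Fin d) → Image (shift A (θ (inject₁ i))) (U (inject₁ i)) ≐ U (suc i))
    × (Image (shift A (θ (fromℕ d))) (U (fromℕ d)) ≐ ZeroSub)
    × (∀ (i : Fin d) → Image (shift As (θs (suc i))) (U (suc i)) ⊆ U (inject₁ i))
    × (Image (shift As (θs zero)) (U zero) ≐ ZeroSub)

  CondII : Mat → Mat → (Fin n → Carrier) → (Fin n → Carrier) → Set (lsuc L)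
  CondII A As θ θs = Σ (Fin n → Subspace) (λ U → IsDecomposition U × CondIIFor A As θ θs U)

  CondIIIFor : Mat → Mat → (Fin n → Carrier) → (Fin n → Carrier)
             → (Fin d → Carrier) → (Fin n → Vec) → Set L
  CondIIIFor A As θ θs φ b =
    IsBasis b × Represents (lowerBidiag θ) A b × Represents (upperBidiag θs φ) As b

  CondIII : Mat → Mat → (Fin n → Carrier) → (Fin n → Carrier) → Set L
  CondIII A As θ θs = Σ (Fin d → Carrier) (λ φ → Σ (Fin n → Vec) (λ b → CondIIIFor A As θ θs φ b))

  Moreover : Mat → (Fin n → Mat) → Mat → (Fin n → Mat)
           → (Fin n → Carrier) → (Fin n → Carrier) → Set (lsuc L)
  Moreover A E As Es θ θs =
    (∀ i → ¬ ((E i *ₘ Es zero) ≈ₘ 0ₘ))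
    × (∀ U → IsDecomposition U → CondIIFor A As θ θs U
         → ∀ i → U i ≐ Range (tau θ A i *ₘ Es zero))
    × (∀ φ b → CondIIIFor A As θ θs φ b →
         Σ Vec (λ ξ → ¬ (ξ ≈ᵥ 0ᵥ) × Range (Es zero) ξ
                     × (∀ i → b i ≈ᵥ (tau θ A i · ξ))
                     × (∀ U → IsDecomposition U → CondIIFor A As θ θs U
                          → ∀ i → span1 (b i) ≐ U i)))
    × (∀ φ b φ' b' → CondIIIFor A As θ θs φ b → CondIIIFor A As θ θs φ' b'
         → ∀ k → φ k ≈ φ' k)

  Proposition7p6 : Set (lsuc L)
  Proposition7p6 =
    ∀ A E As Es θ θs → IsPreLeonardSystem A E As Es θ θs →
      (CondI A E As Es → CondII A As θ θs)
      × (CondII A As θ θs → CondIII A As θ θs)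
      × (CondIII A As θ θs → CondI A E As Es)
      × (CondI A E As Es → CondII A As θ θs → CondIII A As θ θs → Moreover A E As Es θ θs)

module Submission where

-- Everything is read off in the eigenbases of A and A*.  (iii) ⇒ (i): in the basis b, A is lower
-- and A* upper bidiagonal, so E*ᵢ kills b₀,…,bᵢ₋₁ while E*ⱼV ⊆ span(b₀,…,bⱼ), and dually for the Eᵢ;
-- this gives the vanishing pattern of (i), and the subdiagonal 1's of A give the nonvanishing.
-- (i) ⇒ (ii): for 0 ≠ ξ ∈ E*₀V put Uᵢ = span τᵢ(A)ξ; (i) makes A lower Hessenberg with nonzero
-- subdiagonal in the A*-eigenbasis, so τᵢ(A)ξ has leading coordinate i and the Uᵢ decompose V.
-- (ii) ⇒ (iii): τᵢ(A)u₀ for 0 ≠ u₀ ∈ U₀ is the required basis.  Every decomposition and basis as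
-- in (ii), (iii) arises from a θ*₀-eigenvector, i.e. from a multiple of ξ, whence the uniqueness
-- claims.  Equality in F is not decidable, so a family of n vectors is shown to be a basis through
-- a nonvanishing determinant rather than by a dimension count.

open import Defs
open import Level using (Level; 0ℓ; Lift; lift; lower; _⊔_)
open import Data.Empty using (⊥; ⊥-elim)
open import Data.Unit using (⊤; tt)
open import Data.Nat as ℕ using (ℕ; zero; suc; _<_; _≤_; _<?_; s≤s; z≤n)
import Data.Nat.Properties as ℕP
open import Data.Fin as Fin using (Fin; zero; suc; toℕ; punchIn; punchOut; inject₁; fromℕ)
open import Data.Fin.Properties as FinP using (punchInᵢ≢i; toℕ<n; toℕ-injective; punchIn-punchOut; toℕ-inject₁; toℕ-fromℕ)
open import Data.Product using (Σ; _×_; _,_; proj₁; proj₂)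
open import Data.Sum using (_⊎_; inj₁; inj₂)
open import Data.Vec as V using ([]; _∷_)
open import Data.Vec.Properties using (lookup-map; lookup∘tabulate)
open import Function using (_∘_)
import Data.Vec.Functional as VF
open import Relation.Binary using (Rel; Decidable; tri<; tri≈; tri>)
open import Induction.WellFounded as WF using (WellFounded)
import Data.Fin.Induction as FinInd
open import Relation.Binary.PropositionalEquality as P using (_≡_; _≢_)
open import Relation.Nullary using (¬_; yes; no; Dec)
import Algebra.Properties.CommutativeSemigroup

module _ {c ℓ : Level} (F : Field c ℓ) (d : ℕ) where
  open Field F hiding (zero)
  open LinAlg F d
  open import Relation.Binary.Reasoning.Setoid setoid
  open import Algebra.Properties.Ring ring
    using (-‿distribˡ-*; -‿distribʳ-*; -‿involutive; -0#≈0#; -‿+-comm; ⁻¹-anti-homo‿-; x[y-z]≈xy-xz; x∙y⁻¹≈ε⇒x≈y; x≈y⇒x∙y⁻¹≈ε; +-inverseˡ-unique)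

  module +-CS = Algebra.Properties.CommutativeSemigroup +-commutativeSemigroup

  module *-CS = Algebra.Properties.CommutativeSemigroup *-commutativeSemigroup

  x-y+y≈x : ∀ x y → (x - y) + y ≈ x
  x-y+y≈x x y = trans (+-assoc _ _ _) (trans (+-cong refl (-‿inverseˡ y)) (+-identityʳ x))

  -x*-y≈x*y : ∀ x y → (- x) * (- y) ≈ x * y
  -x*-y≈x*y x y = trans (sym (-‿distribˡ-* x (- y))) (trans (-‿cong (sym (-‿distribʳ-* x y))) (-‿involutive _))

  inv : ∀ {x} → (x ≉ 0#) → Carrier
  inv {x} nz = proj₁ (inverse x nz)

  inv-inverseʳ : ∀ {x} (nz : x ≉ 0#) → (x * inv nz) ≈ 1#
  inv-inverseʳ {x} nz = proj₂ (inverse x nz)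

  inv-inverseˡ : ∀ {x} (nz : x ≉ 0#) → (inv nz * x) ≈ 1#
  inv-inverseˡ nz = trans (*-comm _ _) (inv-inverseʳ nz)

  x*y≈0⇒y≈0 : ∀ {x y} → (x ≉ 0#) → (x * y) ≈ 0# → y ≈ 0#
  x*y≈0⇒y≈0 {x} {y} nz e = begin
    y                 ≈⟨ sym (*-identityˡ y) ⟩
    1# * y            ≈⟨ *-cong (sym (inv-inverseˡ nz)) refl ⟩
    (inv nz * x) * y  ≈⟨ *-assoc _ _ _ ⟩
    inv nz * (x * y)  ≈⟨ *-cong refl e ⟩
    inv nz * 0#       ≈⟨ zeroʳ _ ⟩
    0# ∎

  *-preserves-≉0 : ∀ {x y} → (x ≉ 0#) → (y ≉ 0#) → (x * y ≉ 0#)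
  *-preserves-≉0 nx ny e = ny (x*y≈0⇒y≈0 nx e)

  x≉y⇒x-y≉0 : ∀ {x y} → ¬ (x ≈ y) → (x - y ≉ 0#)
  x≉y⇒x-y≉0 ne e = ne (x∙y⁻¹≈ε⇒x≈y _ _ e)

  ≉0-resp-≈ : ∀ {x y} → x ≈ y → (x ≉ 0#) → (y ≉ 0#)
  ≉0-resp-≈ e nz e' = nz (trans e e')

  x≈0∧y≈0⇒x-y≈0 : ∀ {x y} → x ≈ 0# → y ≈ 0# → (x - y) ≈ 0#
  x≈0∧y≈0⇒x-y≈0 e f = trans (+-cong e (-‿cong f)) (trans (+-identityˡ _) -0#≈0#)

  inv-cancel : ∀ a' ia a x → (ia * a) ≈ 1# → ((a' * ia) * (a * x)) ≈ (a' * x)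
  inv-cancel a' ia a x e = begin
    (a' * ia) * (a * x)   ≈⟨ *-assoc a' ia (a * x) ⟩
    a' * (ia * (a * x))   ≈⟨ *-cong refl (sym (*-assoc ia a x)) ⟩
    a' * ((ia * a) * x)   ≈⟨ *-cong refl (*-cong e refl) ⟩
    a' * (1# * x)         ≈⟨ *-cong refl (*-identityˡ x) ⟩
    a' * x ∎

  sumF-cong : ∀ {m} {f g : Fin m → Carrier} → (∀ i → f i ≈ g i) → sumF f ≈ sumF g
  sumF-cong {zero} e = refl
  sumF-cong {suc m} e = +-cong (e zero) (sumF-cong (λ i → e (suc i)))

  sumF-zero : ∀ {m} (f : Fin m → Carrier) → (∀ i → f i ≈ 0#) → sumF f ≈ 0#
  sumF-zero {zero} f e = refl
  sumF-zero {suc m} f e = trans (+-cong (e zero) (sumF-zero (λ i → f (suc i)) (λ i → e (suc i)))) (+-identityʳ _)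

  sumF-+ : ∀ {m} (f g : Fin m → Carrier) → sumF (λ i → f i + g i) ≈ (sumF f + sumF g)
  sumF-+ {zero} f g = sym (+-identityʳ _)
  sumF-+ {suc m} f g = trans (+-cong refl (sumF-+ (λ i → f (suc i)) (λ i → g (suc i)))) (+-CS.interchange _ _ _ _)

  *-distribˡ-sumF : ∀ {m} (a : Carrier) (f : Fin m → Carrier) → (a * sumF f) ≈ sumF (λ i → a * f i)
  *-distribˡ-sumF {zero} a f = zeroʳ a
  *-distribˡ-sumF {suc m} a f = trans (distribˡ _ _ _) (+-cong refl (*-distribˡ-sumF a (λ i → f (suc i))))

  *-distribʳ-sumF : ∀ {m} (a : Carrier) (f : Fin m → Carrier) → (sumF f * a) ≈ sumF (λ i → f i * a)
  *-distribʳ-sumF {m} a f = trans (*-comm _ _) (trans (*-distribˡ-sumF a f) (sumF-cong {m} (λ i → *-comm _ _)))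

  -‿sumF : ∀ {m} (f : Fin m → Carrier) → (- sumF f) ≈ sumF (λ i → - f i)
  -‿sumF {zero} f = -0#≈0#
  -‿sumF {suc m} f = trans (sym (-‿+-comm _ _)) (+-cong refl (-‿sumF (λ i → f (suc i))))

  sumF-comm : ∀ {m k} (f : Fin m → Fin k → Carrier) →
             sumF (λ i → sumF (λ j → f i j)) ≈ sumF (λ j → sumF (λ i → f i j))
  sumF-comm {zero} {k} f = sym (sumF-zero {k} (λ j → 0#) (λ j → refl))
  sumF-comm {suc m} {k} f = begin
    sumF (λ j → f zero j) + sumF (λ i → sumF (λ j → f (suc i) j))
      ≈⟨ +-cong refl (sumF-comm (λ i j → f (suc i) j)) ⟩
    sumF (λ j → f zero j) + sumF (λ j → sumF (λ i → f (suc i) j))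
      ≈⟨ sym (sumF-+ {k} (λ j → f zero j) (λ j → sumF (λ i → f (suc i) j))) ⟩
    sumF (λ j → f zero j + sumF (λ i → f (suc i) j)) ∎

  sumF-punchIn : ∀ {m} (f : Fin (suc m) → Carrier) (j : Fin (suc m)) →
              sumF f ≈ (f j + sumF (λ l → f (punchIn j l)))
  sumF-punchIn {m} f zero = refl
  sumF-punchIn {zero} f (suc ())
  sumF-punchIn {suc m} f (suc j) = begin
    f zero + sumF (λ i → f (suc i))
      ≈⟨ +-cong refl (sumF-punchIn (λ i → f (suc i)) j) ⟩
    f zero + (f (suc j) + sumF (λ l → f (suc (punchIn j l))))
      ≈⟨ +-CS.x∙yz≈y∙xz (f zero) (f (suc j)) _ ⟩
    f (suc j) + (f zero + sumF (λ l → f (suc (punchIn j l)))) ∎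

  sumF-single : ∀ {m} (f : Fin m → Carrier) (j : Fin m) → (∀ i → i ≢ j → f i ≈ 0#) → sumF f ≈ f j
  sumF-single {suc m} f j e = begin
    sumF f ≈⟨ sumF-punchIn f j ⟩
    f j + sumF (λ l → f (punchIn j l)) ≈⟨ +-cong refl (sumF-zero _ (λ l → e (punchIn j l) (punchInᵢ≢i j l))) ⟩
    f j + 0# ≈⟨ +-identityʳ _ ⟩
    f j ∎

  ≈ᵥ-refl : ∀ {u} → u ≈ᵥ u
  ≈ᵥ-refl i = refl

  ≈ᵥ-sym : ∀ {u v} → u ≈ᵥ v → v ≈ᵥ u
  ≈ᵥ-sym e i = sym (e i)

  ≈ᵥ-trans : ∀ {u v w} → u ≈ᵥ v → v ≈ᵥ w → u ≈ᵥ w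
  ≈ᵥ-trans e f i = trans (e i) (f i)

  •-cong : ∀ {a b u v} → a ≈ b → u ≈ᵥ v → (a • u) ≈ᵥ (b • v)
  •-cong e f i = *-cong e (f i)

  vsum-cong : ∀ {m} {u v : Fin m → Vec} → (∀ k → u k ≈ᵥ v k) → vsum u ≈ᵥ vsum v
  vsum-cong {m} e i = sumF-cong {m} (λ k → e k i)

  vsum-zero : ∀ {m} (u : Fin m → Vec) → (∀ k → u k ≈ᵥ 0ᵥ) → vsum u ≈ᵥ 0ᵥ
  vsum-zero {m} u e i = sumF-zero {m} _ (λ k → e k i)

  vsum-single : ∀ {m} (u : Fin m → Vec) j → (∀ k → k ≢ j → u k ≈ᵥ 0ᵥ) → vsum u ≈ᵥ u j
  vsum-single {m} u j e i = sumF-single {m} (λ k → u k i) j (λ k ne → e k ne i)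

  vsum-pair : ∀ {m} (u : Fin (suc m) → Vec) p q → p ≢ q → (∀ k → k ≢ p → k ≢ q → u k ≈ᵥ 0ᵥ) → vsum u ≈ᵥ (u p +ᵥ u q)
  vsum-pair {m} u p q ne h i = trans (sumF-punchIn (λ k → u k i) p) (+-cong refl (trans
     (sumF-single (λ l → u (punchIn p l) i) (punchOut ne) (λ l nl → h (punchIn p l) (FinP.punchInᵢ≢i p l)
         (λ e → nl (FinP.punchIn-injective p l (punchOut ne) (P.trans e (P.sym (punchIn-punchOut ne))))) i))
     (reflexive (P.cong (λ k → u k i) (punchIn-punchOut ne)))))

  •-0ᵥ : ∀ a → (a • 0ᵥ) ≈ᵥ 0ᵥ
  •-0ᵥ a i = zeroʳ a

  0#-• : ∀ v → (0# • v) ≈ᵥ 0ᵥ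
  0#-• v i = zeroˡ (v i)

  •-assoc : ∀ a b v → (a • (b • v)) ≈ᵥ ((a * b) • v)
  •-assoc a b v i = sym (*-assoc a b (v i))

  1#-• : ∀ v → (1# • v) ≈ᵥ v
  1#-• v i = *-identityˡ (v i)

  •≈0ᵥ⇒≈0ᵥ : ∀ {a v} → (a ≉ 0#) → (a • v) ≈ᵥ 0ᵥ → v ≈ᵥ 0ᵥ
  •≈0ᵥ⇒≈0ᵥ nz e i = x*y≈0⇒y≈0 nz (e i)

  u-v≈0⇒u≈v : ∀ {u v} → (u -ᵥ v) ≈ᵥ 0ᵥ → u ≈ᵥ v
  u-v≈0⇒u≈v e i = x∙y⁻¹≈ε⇒x≈y _ _ (e i)

  u≈v⇒u-v≈0 : ∀ {u v} → u ≈ᵥ v → (u -ᵥ v) ≈ᵥ 0ᵥ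
  u≈v⇒u-v≈0 e i = x≈y⇒x∙y⁻¹≈ε (e i)

  •-≉0ᵥ⇒≉0 : ∀ {s v w} → w ≈ᵥ (s • v) → ¬ (w ≈ᵥ 0ᵥ) → s ≉ 0#
  •-≉0ᵥ⇒≉0 {v = v} w≈ w≉0 s≈0 = w≉0 (≈ᵥ-trans w≈ (≈ᵥ-trans (•-cong {v = v} s≈0 ≈ᵥ-refl) (0#-• v)))

  •-cancel : ∀ {s u v} → (s ≉ 0#) → (s • u) ≈ᵥ (s • v) → u ≈ᵥ v
  •-cancel {s} {u} {v} nz e = u-v≈0⇒u≈v (•≈0ᵥ⇒≈0ᵥ nz (λ r → trans (x[y-z]≈xy-xz s (u r) (v r)) (x≈y⇒x∙y⁻¹≈ε (e r))))

  lincomb--ᵥ : ∀ {m} (a b : Fin m → Carrier) (x : Fin m → Vec) →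
     vsum (λ l → (a l - b l) • x l) ≈ᵥ (vsum (λ l → a l • x l) -ᵥ vsum (λ l → b l • x l))
  lincomb--ᵥ {m} a b x i = begin
    sumF (λ l → (a l + (- b l)) * x l i)
      ≈⟨ sumF-cong {m} {λ l → (a l + (- b l)) * x l i} {λ l → a l * x l i + (- (b l * x l i))}
            (λ l → trans (distribʳ (x l i) (a l) (- b l)) (+-cong refl (sym (-‿distribˡ-* _ _)))) ⟩
    sumF (λ l → a l * x l i + (- (b l * x l i)))
      ≈⟨ sumF-+ {m} (λ l → a l * x l i) (λ l → - (b l * x l i)) ⟩
    sumF (λ l → a l * x l i) + sumF (λ l → - (b l * x l i))
      ≈⟨ +-cong refl (sym (-‿sumF {m} (λ l → b l * x l i))) ⟩
    sumF (λ l → a l * x l i) + (- sumF (λ l → b l * x l i)) ∎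

  •-lincomb : ∀ {m} μ (a : Fin m → Carrier) (b : Fin m → Vec) → (μ • vsum (λ l → a l • b l)) ≈ᵥ vsum (λ l → (μ * a l) • b l)
  •-lincomb {m} μ a b i = trans (*-distribˡ-sumF μ (λ l → a l * b l i)) (sumF-cong {m} {λ l → μ * (a l * b l i)} {λ l → (μ * a l) * b l i} (λ l → sym (*-assoc _ _ _)))

  lincomb-zero : ∀ {m} (a : Fin m → Carrier) (z : Fin m → Vec) → (∀ k → (a k ≈ 0#) ⊎ (z k ≈ᵥ 0ᵥ)) → vsum (λ k → a k • z k) ≈ᵥ 0ᵥ
  lincomb-zero a z h = vsum-zero (λ k → a k • z k) (λ k → f k (h k))
    where
    f : ∀ k → (a k ≈ 0#) ⊎ (z k ≈ᵥ 0ᵥ) → (a k • z k) ≈ᵥ 0ᵥ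
    f k (inj₁ e) = ≈ᵥ-trans (•-cong {v = z k} e ≈ᵥ-refl) (0#-• (z k))
    f k (inj₂ e) = ≈ᵥ-trans (•-cong {a k} refl e) (•-0ᵥ (a k))

  Iₘ-diag : ∀ i → Iₘ i i ≈ 1#
  Iₘ-diag i with i Fin.≟ i
  ... | yes _ = refl
  ... | no ne = ⊥-elim (ne P.refl)

  Iₘ-offDiag : ∀ i j → i ≢ j → Iₘ i j ≈ 0#
  Iₘ-offDiag i j ne with i Fin.≟ j
  ... | yes e = ⊥-elim (ne e)
  ... | no _ = refl

  unitVec : Fin n → Vec
  unitVec k i = Iₘ i k

  ·-cong : ∀ {M N : Mat} {u v} → M ≈ₘ N → u ≈ᵥ v → (M · u) ≈ᵥ (N · v)
  ·-cong eM ev i = sumF-cong {n} (λ j → *-cong (eM i j) (ev j))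

  ·-• : ∀ (M : Mat) a v → (M · (a • v)) ≈ᵥ (a • (M · v))
  ·-• M a v i = trans (sumF-cong {n} (λ j → *-CS.x∙yz≈y∙xz (M i j) a (v j))) (sym (*-distribˡ-sumF a (λ j → M i j * v j)))

  ·--ᵥ : ∀ (M : Mat) u v → (M · (u -ᵥ v)) ≈ᵥ ((M · u) -ᵥ (M · v))
  ·--ᵥ M u v i = trans (sumF-cong {n} (λ j → x[y-z]≈xy-xz (M i j) (u j) (v j)))
                    (trans (sumF-+ {n} (λ j → M i j * u j) (λ j → - (M i j * v j))) (+-cong refl (sym (-‿sumF {n} (λ j → M i j * v j)))))

  ·-0ᵥ : ∀ (M : Mat) → (M · 0ᵥ) ≈ᵥ 0ᵥ
  ·-0ᵥ M i = sumF-zero {n} (λ j → M i j * 0#) (λ j → zeroʳ (M i j))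

  ·-vsum : ∀ {m} (M : Mat) (u : Fin m → Vec) → (M · vsum u) ≈ᵥ vsum (λ k → M · u k)
  ·-vsum {m} M u i = begin
    sumF (λ j → M i j * sumF (λ k → u k j)) ≈⟨ sumF-cong {n} (λ j → *-distribˡ-sumF (M i j) (λ k → u k j)) ⟩
    sumF (λ j → sumF (λ k → M i j * u k j)) ≈⟨ sumF-comm {n} {m} (λ j k → M i j * u k j) ⟩
    sumF (λ k → sumF (λ j → M i j * u k j)) ∎

  ·-lincomb : ∀ {m} (M : Mat) (a : Fin m → Carrier) (u : Fin m → Vec) →
            (M · vsum (λ k → a k • u k)) ≈ᵥ vsum (λ k → a k • (M · u k))
  ·-lincomb {m} M a u i = trans (·-vsum M (λ k → a k • u k) i) (sumF-cong {m} {λ k → (M · (a k • u k)) i} (λ k → ·-• M (a k) (u k) i))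

  *ₘ-· : ∀ (M N : Mat) v → ((M *ₘ N) · v) ≈ᵥ (M · (N · v))
  *ₘ-· M N v i = begin
    sumF (λ j → sumF (λ k → M i k * N k j) * v j)   ≈⟨ sumF-cong {n} (λ j → *-distribʳ-sumF (v j) (λ k → M i k * N k j)) ⟩
    sumF (λ j → sumF (λ k → (M i k * N k j) * v j)) ≈⟨ sumF-comm {n} {n} (λ j k → (M i k * N k j) * v j) ⟩
    sumF (λ k → sumF (λ j → (M i k * N k j) * v j)) ≈⟨ sumF-cong {n} (λ k → trans (sumF-cong {n} {λ j → (M i k * N k j) * v j} (λ j → *-assoc _ _ _)) (sym (*-distribˡ-sumF (M i k) (λ j → N k j * v j)))) ⟩
    sumF (λ k → M i k * sumF (λ j → N k j * v j)) ∎

  *ₘ-·₃ : ∀ (X Y Z : Mat) v → (((X *ₘ Y) *ₘ Z) · v) ≈ᵥ (X · (Y · (Z · v)))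
  *ₘ-·₃ X Y Z v = ≈ᵥ-trans (*ₘ-· (X *ₘ Y) Z v) (*ₘ-· X Y (Z · v))

  Iₘ-· : ∀ v → (Iₘ · v) ≈ᵥ v
  Iₘ-· v i = trans (sumF-single {n} (λ j → Iₘ i j * v j) i (λ j ne → trans (*-cong (Iₘ-offDiag i j (λ e → ne (P.sym e))) refl) (zeroˡ _)))
                   (trans (*-cong (Iₘ-diag i) refl) (*-identityˡ _))

  ·-unitVec : ∀ (M : Mat) k → (M · unitVec k) ≈ᵥ (λ i → M i k)
  ·-unitVec M k i = trans (sumF-single {n} (λ j → M i j * Iₘ j k) k (λ j ne → trans (*-cong refl (Iₘ-offDiag j k ne)) (zeroʳ _)))
                   (trans (*-cong refl (Iₘ-diag k)) (*-identityʳ _))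

  •ₘ-· : ∀ a (M : Mat) v → ((a •ₘ M) · v) ≈ᵥ (a • (M · v))
  •ₘ-· a M v i = trans (sumF-cong {n} {λ j → (a * M i j) * v j} (λ j → *-assoc _ _ _)) (sym (*-distribˡ-sumF a (λ j → M i j * v j)))

  shift-· : ∀ (X : Mat) a v → (shift X a · v) ≈ᵥ ((X · v) -ᵥ (a • v))
  shift-· X a v i = begin
    sumF (λ j → (X i j + (- (a * Iₘ i j))) * v j)
      ≈⟨ sumF-cong {n} (λ j → trans (distribʳ (v j) (X i j) (- (a * Iₘ i j))) (+-cong refl (sym (-‿distribˡ-* (a * Iₘ i j) (v j))))) ⟩
    sumF (λ j → X i j * v j + (- ((a * Iₘ i j) * v j)))
      ≈⟨ sumF-+ {n} (λ j → X i j * v j) (λ j → - ((a * Iₘ i j) * v j)) ⟩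
    (X · v) i + sumF (λ j → - ((a * Iₘ i j) * v j))
      ≈⟨ +-cong refl (sym (-‿sumF {n} (λ j → (a * Iₘ i j) * v j))) ⟩
    (X · v) i + (- sumF (λ j → (a * Iₘ i j) * v j))
      ≈⟨ +-cong refl (-‿cong (•ₘ-· a Iₘ v i)) ⟩
    (X · v) i + (- (a * (Iₘ · v) i))
      ≈⟨ +-cong refl (-‿cong (*-cong refl (Iₘ-· v i))) ⟩
    (X · v) i + (- (a * v i)) ∎

  shift-·-solve : ∀ X a v w → (shift X a · v) ≈ᵥ w → (X · v) ≈ᵥ ((a • v) +ᵥ w)
  shift-·-solve X a v w e i = begin
    (X · v) i                              ≈⟨ sym (x-y+y≈x ((X · v) i) (a * v i)) ⟩
    ((X · v) i + (- (a * v i))) + (a * v i) ≈⟨ +-cong (trans (sym (shift-· X a v i)) (e i)) refl ⟩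
    w i + (a * v i)                         ≈⟨ +-comm _ _ ⟩
    (a * v i) + w i ∎

  shift-·-unsolve : ∀ X a v w → (X · v) ≈ᵥ ((a • v) +ᵥ w) → (shift X a · v) ≈ᵥ w
  shift-·-unsolve X a v w e i = begin
    (shift X a · v) i          ≈⟨ shift-· X a v i ⟩
    (X · v) i - a * v i        ≈⟨ +-cong (e i) refl ⟩
    (a * v i + w i) - a * v i  ≈⟨ +-CS.xy∙z≈y∙xz (a * v i) (w i) (- (a * v i)) ⟩
    w i + (a * v i - a * v i)  ≈⟨ +-cong refl (-‿inverseʳ _) ⟩
    w i + 0#                   ≈⟨ +-identityʳ _ ⟩
    w i ∎

  shift-·-comm : ∀ X a b' v → (shift X a · (shift X b' · v)) ≈ᵥ (shift X b' · (shift X a · v))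
  shift-·-comm X a b' v i = begin
    (shift X a · (shift X b' · v)) i
      ≈⟨ shift-· X a (shift X b' · v) i ⟩
    (X · (shift X b' · v)) i + (- (a * (shift X b' · v) i))
      ≈⟨ +-cong (·-cong {X} {X} {shift X b' · v} {(X · v) -ᵥ (b' • v)} (λ _ _ → refl) (shift-· X b' v) i) (-‿cong (*-cong refl (shift-· X b' v i))) ⟩
    (X · ((X · v) -ᵥ (b' • v))) i + (- (a * ((X · v) i + (- (b' * v i)))))
      ≈⟨ +-cong (trans (·--ᵥ X (X · v) (b' • v) i) (+-cong refl (-‿cong (·-• X b' v i)))) refl ⟩
    ((X · (X · v)) i + (- (b' * (X · v) i))) + (- (a * ((X · v) i + (- (b' * v i)))))
      ≈⟨ key (X · (X · v)) i ((X · v) i) (v i) ⟩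
    ((X · (X · v)) i + (- (a * (X · v) i))) + (- (b' * ((X · v) i + (- (a * v i)))))
      ≈⟨ sym (+-cong (trans (·--ᵥ X (X · v) (a • v) i) (+-cong refl (-‿cong (·-• X a v i)))) refl) ⟩
    (X · ((X · v) -ᵥ (a • v))) i + (- (b' * ((X · v) i + (- (a * v i)))))
      ≈⟨ sym (+-cong (·-cong {X} {X} {shift X a · v} {(X · v) -ᵥ (a • v)} (λ _ _ → refl) (shift-· X a v) i) (-‿cong (*-cong refl (shift-· X a v i)))) ⟩
    (X · (shift X a · v)) i + (- (b' * (shift X a · v) i))
      ≈⟨ sym (shift-· X b' (shift X a · v) i) ⟩
    (shift X b' · (shift X a · v)) i ∎
    where
    expand : ∀ P Q w (s t : Carrier) → ((P + (- (t * Q))) + (- (s * (Q + (- (t * w)))))) ≈ (((P + (- (t * Q))) + (- (s * Q))) + ((s * t) * w))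
    expand P Q w s t = begin
      (P + (- (t * Q))) + (- (s * (Q + (- (t * w)))))
        ≈⟨ +-cong refl (-‿cong (x[y-z]≈xy-xz s Q (t * w))) ⟩
      (P + (- (t * Q))) + (- ((s * Q) + (- (s * (t * w)))))
        ≈⟨ +-cong refl (⁻¹-anti-homo‿- (s * Q) (s * (t * w))) ⟩
      (P + (- (t * Q))) + ((s * (t * w)) + (- (s * Q)))
        ≈⟨ +-cong refl (+-comm _ _) ⟩
      (P + (- (t * Q))) + ((- (s * Q)) + (s * (t * w)))
        ≈⟨ sym (+-assoc _ _ _) ⟩
      ((P + (- (t * Q))) + (- (s * Q))) + (s * (t * w))
        ≈⟨ +-cong refl (sym (*-assoc s t w)) ⟩
      ((P + (- (t * Q))) + (- (s * Q))) + ((s * t) * w) ∎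
    key : ∀ P i Q w → ((P i + (- (b' * Q))) + (- (a * (Q + (- (b' * w)))))) ≈ ((P i + (- (a * Q))) + (- (b' * (Q + (- (a * w))))))
    key P i Q w = begin
      (P i + (- (b' * Q))) + (- (a * (Q + (- (b' * w)))))
        ≈⟨ expand (P i) Q w a b' ⟩
      ((P i + (- (b' * Q))) + (- (a * Q))) + ((a * b') * w)
        ≈⟨ +-cong (trans (+-assoc _ _ _) (trans (+-cong refl (+-comm _ _)) (sym (+-assoc _ _ _)))) (*-cong (*-comm a b') refl) ⟩
      ((P i + (- (a * Q))) + (- (b' * Q))) + ((b' * a) * w)
        ≈⟨ sym (expand (P i) Q w b' a) ⟩
      (P i + (- (a * Q))) + (- (b' * (Q + (- (a * w))))) ∎

  ≈0ₘ⇒·≈0ᵥ : ∀ {M : Mat} → M ≈ₘ 0ₘ → ∀ v → (M · v) ≈ᵥ 0ᵥ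
  ≈0ₘ⇒·≈0ᵥ {M} e v i = sumF-zero {n} (λ j → M i j * v j) (λ j → trans (*-cong (e i j) refl) (zeroˡ (v j)))

  ·≈0ᵥ⇒≈0ₘ : ∀ {M : Mat} → (∀ v → (M · v) ≈ᵥ 0ᵥ) → M ≈ₘ 0ₘ
  ·≈0ᵥ⇒≈0ₘ {M} h i k = trans (sym (·-unitVec M k i)) (h (unitVec k) i)

  ·-ext : ∀ {M N : Mat} → (∀ v → (M · v) ≈ᵥ (N · v)) → M ≈ₘ N
  ·-ext {M} {N} h i k = trans (sym (·-unitVec M k i)) (trans (h (unitVec k) i) (·-unitVec N k i))

  shift-·-eigen : ∀ {X θ v} μ → InEigenspace X θ v → (shift X μ · v) ≈ᵥ ((θ - μ) • v)
  shift-·-eigen {X} {θ} {v} μ e i = trans (shift-· X μ v i) (trans (+-cong (e i) refl)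
    (sym (trans (distribʳ (v i) θ (- μ)) (+-cong refl (sym (-‿distribˡ-* μ (v i)))))))

  InEigenspace-cong : ∀ X μ {u v} → u ≈ᵥ v → InEigenspace X μ u → InEigenspace X μ v
  InEigenspace-cong X μ {u} {v} e eu i = trans (·-cong {X} {X} {v} {u} (λ _ _ → refl) (≈ᵥ-sym e) i) (trans (eu i) (*-cong refl (e i)))

  InEigenspace-• : ∀ {X θ v} a → InEigenspace X θ v → InEigenspace X θ (a • v)
  InEigenspace-• {X} {θ} {v} a e i = trans (·-• X a v i) (trans (*-cong refl (e i)) (trans (sym (*-assoc _ _ _)) (trans (*-cong (*-comm _ _) refl) (*-assoc _ _ _))))

  InEigenspace--ᵥ : ∀ X θ u v → InEigenspace X θ u → InEigenspace X θ v → InEigenspace X θ (u -ᵥ v)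
  InEigenspace--ᵥ X θ u v eu ev i = trans (·--ᵥ X u v i) (trans (+-cong (eu i) (-‿cong (ev i))) (sym (x[y-z]≈xy-xz θ (u i) (v i))))

  -- Determinants

  Row : ℕ → Set c
  Row k = Fin k → Carrier

  Rows : ℕ → ℕ → Set c
  Rows k m = V.Vec (Row k) m

  sign : ℕ → Carrier
  sign zero = 1#
  sign (suc m) = - sign m

  det : ∀ {k} → Rows k k → Carrier
  det {zero} [] = 1#
  det {suc k} (a ∷ rs) = sumF (λ j → (sign (toℕ j) * a j) * det (V.map (λ r → r ∘ punchIn j) rs))

  RowsEq : ∀ {k m} → Rows k m → Rows k m → Set (c ⊔ ℓ)
  RowsEq [] [] = Lift _ ⊤
  RowsEq (a ∷ as) (b ∷ bs) = (∀ j → a j ≈ b j) × RowsEq as bs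

  RowsEq-refl : ∀ {k m} (S : Rows k m) → RowsEq S S
  RowsEq-refl [] = lift tt
  RowsEq-refl (a ∷ S) = (λ j → refl) , RowsEq-refl S

  RowsEq-map : ∀ {k k' m} (f g : Row k → Row k') → (S : Rows k m) → (∀ r j → f r j ≈ g r j) → RowsEq (V.map f S) (V.map g S)
  RowsEq-map f g [] e = lift tt
  RowsEq-map f g (a ∷ S) e = e a , RowsEq-map f g S e

  RowsEq-map2 : ∀ {k k' m} (f : Row k → Row k') → (S S' : Rows k m) → (∀ r r' → (∀ j → r j ≈ r' j) → ∀ j → f r j ≈ f r' j) → RowsEq S S' → RowsEq (V.map f S) (V.map f S')
  RowsEq-map2 f [] [] fc e = lift tt
  RowsEq-map2 f (a ∷ S) (b ∷ S') fc (e , es) = fc a b e , RowsEq-map2 f S S' fc es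

  RowsEq-mapmap : ∀ {k k' k'' m} (f : Row k' → Row k'') (g : Row k → Row k') (h : Row k → Row k'') → (S : Rows k m) → (∀ r j → f (g r) j ≈ h r j) → RowsEq (V.map f (V.map g S)) (V.map h S)
  RowsEq-mapmap f g h [] e = lift tt
  RowsEq-mapmap f g h (a ∷ S) e = e a , RowsEq-mapmap f g h S e

  det-cong : ∀ {k} (S S' : Rows k k) → RowsEq S S' → det S ≈ det S'
  det-cong {zero} [] [] e = refl
  det-cong {suc k} (a ∷ S) (b ∷ S') (e , es) = sumF-cong {suc k} {λ j → (sign (toℕ j) * a j) * det (V.map (λ r → r ∘ punchIn j) S)} (λ j → *-cong (*-cong refl (e j))
     (det-cong (V.map (λ r → r ∘ punchIn j) S) (V.map (λ r → r ∘ punchIn j) S')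
        (RowsEq-map2 (λ r → r ∘ punchIn j) S S' (λ r r' e' x → e' (punchIn j x)) es)))

  Alternating : ∀ {L m} → (Rows L (suc m) → Carrier) → Set (c ⊔ ℓ)
  Alternating {L} {zero} D = Lift _ ⊤
  Alternating {L} {suc m} D = (∀ a S → D (a ∷ a ∷ S) ≈ 0#)
                     × (∀ a b S → D (a ∷ b ∷ S) ≈ (- D (b ∷ a ∷ S)))
                     × (∀ x → Alternating {L} {m} (λ T → D (x ∷ T)))

  Alternating-lincomb : ∀ {L L' m ι} (cs : Fin ι → Carrier) (f : Fin ι → Row L → Row L')
             (D : Fin ι → Rows L' (suc m) → Carrier) →
             (∀ j → Alternating (D j)) → Alternating {L} {m} (λ T → sumF (λ j → cs j * D j (V.map (f j) T)))
  Alternating-lincomb {m = zero} cs f D h = lift tt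
  Alternating-lincomb {m = suc m} {ι} cs f D h =
      (λ a S → sumF-zero {ι} (λ j → cs j * D j (V.map (f j) (a ∷ a ∷ S)))
                 (λ j → trans (*-cong refl (proj₁ (h j) (f j a) (V.map (f j) S))) (zeroʳ _)))
    , (λ a b S → trans (sumF-cong {ι} {λ j → cs j * D j (V.map (f j) (a ∷ b ∷ S))}
                          (λ j → trans (*-cong refl (proj₁ (proj₂ (h j)) (f j a) (f j b) (V.map (f j) S))) (sym (-‿distribʳ-* _ _))))
                       (sym (-‿sumF {ι} (λ j → cs j * D j (V.map (f j) (b ∷ a ∷ S))))))
    , (λ x → Alternating-lincomb cs f (λ j T → D j (f j x ∷ T)) (λ j → proj₂ (proj₂ (h j)) (f j x)))

  punchOut′ : ∀ {k} → Fin (suc (suc k)) → Fin (suc (suc k)) → Fin (suc k)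
  punchOut′ zero zero = zero
  punchOut′ zero (suc q) = q
  punchOut′ (suc j) zero = zero
  punchOut′ {zero} (suc j) (suc q) = zero
  punchOut′ {suc k} (suc j) (suc q) = suc (punchOut′ {k} j q)

  punchOut′-punchIn : ∀ {k} (j : Fin (suc (suc k))) (l : Fin (suc k)) → punchOut′ j (punchIn j l) ≡ l
  punchOut′-punchIn zero l = P.refl
  punchOut′-punchIn (suc j) zero = P.refl
  punchOut′-punchIn {zero} (suc j) (suc ())
  punchOut′-punchIn {suc k} (suc j) (suc l) = P.cong suc (punchOut′-punchIn j l)

  punchIn-punchOut′ : ∀ {k} (j q : Fin (suc (suc k))) → j ≢ q → punchIn j (punchOut′ j q) ≡ q
  punchIn-punchOut′ zero zero ne = ⊥-elim (ne P.refl)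
  punchIn-punchOut′ zero (suc q) ne = P.refl
  punchIn-punchOut′ (suc j) zero ne = P.refl
  punchIn-punchOut′ {zero} (suc zero) (suc zero) ne = ⊥-elim (ne P.refl)
  punchIn-punchOut′ {suc k} (suc j) (suc q) ne = P.cong suc (punchIn-punchOut′ j q (λ e → ne (P.cong suc e)))

  punchIn-punchOut′-comm : ∀ {k} (j q : Fin (suc (suc k))) → j ≢ q → (x : Fin k) →
             punchIn j (punchIn (punchOut′ j q) x) ≡ punchIn q (punchIn (punchOut′ q j) x)
  punchIn-punchOut′-comm zero zero ne x = ⊥-elim (ne P.refl)
  punchIn-punchOut′-comm zero (suc q) ne x = P.refl
  punchIn-punchOut′-comm (suc j) zero ne x = P.refl
  punchIn-punchOut′-comm {zero} (suc j) (suc q) ne ()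
  punchIn-punchOut′-comm {suc k} (suc j) (suc q) ne zero = P.refl
  punchIn-punchOut′-comm {suc k} (suc j) (suc q) ne (suc x) = P.cong suc (punchIn-punchOut′-comm j q (λ e → ne (P.cong suc e)) x)

  sign-punchOut′-antisym : ∀ {k} (j q : Fin (suc (suc k))) → j ≢ q →
             (sign (toℕ j) * sign (toℕ (punchOut′ j q))) ≈ (- (sign (toℕ q) * sign (toℕ (punchOut′ q j))))
  sign-punchOut′-antisym zero zero ne = ⊥-elim (ne P.refl)
  sign-punchOut′-antisym zero (suc q) ne = trans (*-identityˡ _) (sym (trans (-‿cong (*-identityʳ _)) (-‿involutive _)))
  sign-punchOut′-antisym (suc j) zero ne = trans (*-identityʳ _) (-‿cong (sym (*-identityˡ _)))
  sign-punchOut′-antisym {zero} (suc zero) (suc zero) ne = ⊥-elim (ne P.refl)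
  sign-punchOut′-antisym {suc k} (suc j) (suc q) ne =
    trans (-x*-y≈x*y _ _) (trans (sign-punchOut′-antisym j q (λ e → ne (P.cong suc e))) (-‿cong (sym (-x*-y≈x*y _ _))))

  χ< : ∀ {m} → Fin m → Fin m → Carrier
  χ< zero zero = 0#
  χ< zero (suc q) = 1#
  χ< (suc j) zero = 0#
  χ< (suc j) (suc q) = χ< j q

  χ<-irrefl : ∀ {m} (j : Fin m) → χ< j j ≈ 0#
  χ<-irrefl zero = refl
  χ<-irrefl (suc j) = χ<-irrefl j

  χ<-total : ∀ {m} (j q : Fin m) → j ≢ q → (χ< j q + χ< q j) ≈ 1#
  χ<-total zero zero ne = ⊥-elim (ne P.refl)
  χ<-total zero (suc q) ne = +-identityʳ _
  χ<-total (suc j) zero ne = +-identityˡ _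
  χ<-total (suc j) (suc q) ne = χ<-total j q (λ e → ne (P.cong suc e))

  -- Expanding along the first two rows, det (a ∷ b ∷ S) splits into the terms with column of a before
  -- the column of b and those after it; swapping a and b exchanges the two halves up to sign.
  module DoubleExpansion {k : ℕ} where
    Row₂ : Set c
    Row₂ = Row (suc (suc k))

    minor₂ : Rows (suc (suc k)) k → Fin (suc (suc k)) → Fin (suc (suc k)) → Carrier
    minor₂ S j q = det (V.map (λ r x → r (punchIn j (punchIn (punchOut′ j q) x))) S)

    term₂ : Row₂ → Row₂ → Rows (suc (suc k)) k → Fin (suc (suc k)) → Fin (suc (suc k)) → Carrier
    term₂ a b S j q = (sign (toℕ j) * sign (toℕ (punchOut′ j q))) * ((a j * b q) * minor₂ S j q)

    orderedHalf : Row₂ → Row₂ → Rows (suc (suc k)) k → Carrier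
    orderedHalf a b S = sumF (λ p → sumF (λ r → χ< p r * term₂ a b S p r))

    *-rearrange₅ : ∀ s x t y D → ((s * x) * ((t * y) * D)) ≈ ((s * t) * ((x * y) * D))
    *-rearrange₅ s x t y D = begin
      (s * x) * ((t * y) * D) ≈⟨ *-cong refl (*-assoc t y D) ⟩
      (s * x) * (t * (y * D)) ≈⟨ (*-CS.interchange s x t (y * D)) ⟩
      (s * t) * (x * (y * D)) ≈⟨ *-cong refl (sym (*-assoc x y D)) ⟩
      (s * t) * ((x * y) * D) ∎

    expand-first-row : ∀ a b S (j : Fin (suc (suc k))) →
      ((sign (toℕ j) * a j) * det (V.map (λ r → r ∘ punchIn j) (b ∷ S)))
        ≈ sumF (λ l → term₂ a b S j (punchIn j l))
    expand-first-row a b S j = begin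
      (sign (toℕ j) * a j) * sumF (λ l → (sign (toℕ l) * b (punchIn j l)) * det (V.map (λ r → r ∘ punchIn l) (V.map (λ r → r ∘ punchIn j) S)))
        ≈⟨ *-distribˡ-sumF (sign (toℕ j) * a j) (λ l → (sign (toℕ l) * b (punchIn j l)) * det (V.map (λ r → r ∘ punchIn l) (V.map (λ r → r ∘ punchIn j) S))) ⟩
      sumF (λ l → (sign (toℕ j) * a j) * ((sign (toℕ l) * b (punchIn j l)) * det (V.map (λ r → r ∘ punchIn l) (V.map (λ r → r ∘ punchIn j) S))))
        ≈⟨ sumF-cong {suc k} {λ l → (sign (toℕ j) * a j) * ((sign (toℕ l) * b (punchIn j l)) * det (V.map (λ r → r ∘ punchIn l) (V.map (λ r → r ∘ punchIn j) S)))}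
                            {λ l → term₂ a b S j (punchIn j l)}
             (λ l → trans (*-rearrange₅ (sign (toℕ j)) (a j) (sign (toℕ l)) (b (punchIn j l)) (det (V.map (λ r → r ∘ punchIn l) (V.map (λ r → r ∘ punchIn j) S))))
                (*-cong (*-cong refl (reflexive (P.cong (λ t → sign (toℕ t)) (P.sym (punchOut′-punchIn j l)))))
              (*-cong refl (det-cong _ _ (RowsEq-mapmap (λ r → r ∘ punchIn l) (λ r → r ∘ punchIn j) (λ r x → r (punchIn j (punchIn (punchOut′ j (punchIn j l)) x))) S
                 (λ r x → reflexive (P.cong (λ t → r (punchIn j (punchIn t x))) (P.sym (punchOut′-punchIn j l))))))))) ⟩
      sumF (λ l → term₂ a b S j (punchIn j l)) ∎

    split-off-diagonal : ∀ a b S (j : Fin (suc (suc k))) →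
      sumF (λ l → term₂ a b S j (punchIn j l)) ≈ sumF (λ q → (χ< j q + χ< q j) * term₂ a b S j q)
    split-off-diagonal a b S j = sym (begin
      sumF (λ q → (χ< j q + χ< q j) * term₂ a b S j q)
        ≈⟨ sumF-punchIn (λ q → (χ< j q + χ< q j) * term₂ a b S j q) j ⟩
      ((χ< j j + χ< j j) * term₂ a b S j j) + sumF (λ l → (χ< j (punchIn j l) + χ< (punchIn j l) j) * term₂ a b S j (punchIn j l))
        ≈⟨ +-cong (trans (*-cong (trans (+-cong (χ<-irrefl j) (χ<-irrefl j)) (+-identityʳ _)) refl) (zeroˡ _))
                  (sumF-cong {suc k} {λ l → (χ< j (punchIn j l) + χ< (punchIn j l) j) * term₂ a b S j (punchIn j l)} {λ l → term₂ a b S j (punchIn j l)} (λ l → trans (*-cong (χ<-total j (punchIn j l) (λ e → punchInᵢ≢i j l (P.sym e))) refl) (*-identityˡ _))) ⟩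
      0# + sumF (λ l → term₂ a b S j (punchIn j l))
        ≈⟨ +-identityˡ _ ⟩
      sumF (λ l → term₂ a b S j (punchIn j l)) ∎)

    term₂-swap : ∀ a b S (q j : Fin (suc (suc k))) → (χ< q j * term₂ a b S j q) ≈ (- (χ< q j * term₂ b a S q j))
    term₂-swap a b S q j with q Fin.≟ j
    ... | yes P.refl = trans (*-cong (χ<-irrefl q) refl) (trans (zeroˡ _) (sym (trans (-‿cong (trans (*-cong (χ<-irrefl q) refl) (zeroˡ _))) -0#≈0#)))
    ... | no ne = trans (*-cong refl kn) (sym (-‿distribʳ-* _ _))
      where
      kn : term₂ a b S j q ≈ (- term₂ b a S q j)
      kn = begin
        (sign (toℕ j) * sign (toℕ (punchOut′ j q))) * ((a j * b q) * minor₂ S j q)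
          ≈⟨ *-cong (sign-punchOut′-antisym j q (λ e → ne (P.sym e))) (*-cong (*-comm _ _)
               (det-cong _ _ (RowsEq-map _ _ S (λ r x → reflexive (P.cong r (punchIn-punchOut′-comm j q (λ e → ne (P.sym e)) x)))))) ⟩
        (- (sign (toℕ q) * sign (toℕ (punchOut′ q j)))) * ((b q * a j) * minor₂ S q j)
          ≈⟨ (sym (-‿distribˡ-* _ _)) ⟩
        - term₂ b a S q j ∎

    det-two-rows : ∀ a b S → det (a ∷ b ∷ S) ≈ (orderedHalf a b S + (- orderedHalf b a S))
    det-two-rows a b S = begin
      det (a ∷ b ∷ S)
        ≈⟨ sumF-cong {N} {λ j → (sign (toℕ j) * a j) * det (V.map (λ r → r ∘ punchIn j) (b ∷ S))} {λ j → sumF (λ q → (χ< j q + χ< q j) * term₂ a b S j q)}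
             (λ j → trans (expand-first-row a b S j) (split-off-diagonal a b S j)) ⟩
      sumF (λ j → sumF (λ q → (χ< j q + χ< q j) * term₂ a b S j q))
        ≈⟨ sumF-cong {N} {λ j → sumF (λ q → (χ< j q + χ< q j) * term₂ a b S j q)} {λ j → sumF (λ q → χ< j q * term₂ a b S j q) + sumF (λ q → χ< q j * term₂ a b S j q)}
             (λ j → trans (sumF-cong {N} {λ q → (χ< j q + χ< q j) * term₂ a b S j q} {λ q → χ< j q * term₂ a b S j q + χ< q j * term₂ a b S j q} (λ q → distribʳ _ _ _))
                          (sumF-+ {N} (λ q → χ< j q * term₂ a b S j q) (λ q → χ< q j * term₂ a b S j q))) ⟩
      sumF (λ j → sumF (λ q → χ< j q * term₂ a b S j q) + sumF (λ q → χ< q j * term₂ a b S j q))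
        ≈⟨ sumF-+ {N} (λ j → sumF (λ q → χ< j q * term₂ a b S j q)) (λ j → sumF (λ q → χ< q j * term₂ a b S j q)) ⟩
      orderedHalf a b S + sumF (λ j → sumF (λ q → χ< q j * term₂ a b S j q))
        ≈⟨ +-cong refl (sumF-comm {N} {N} (λ j q → χ< q j * term₂ a b S j q)) ⟩
      orderedHalf a b S + sumF (λ q → sumF (λ j → χ< q j * term₂ a b S j q))
        ≈⟨ +-cong refl (sumF-cong {N} {λ q → sumF (λ j → χ< q j * term₂ a b S j q)} {λ q → - sumF (λ j → χ< q j * term₂ b a S q j)}
              (λ q → trans (sumF-cong {N} {λ j → χ< q j * term₂ a b S j q} {λ j → - (χ< q j * term₂ b a S q j)} (λ j → term₂-swap a b S q j))
                           (sym (-‿sumF {N} (λ j → χ< q j * term₂ b a S q j))))) ⟩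
      orderedHalf a b S + sumF (λ q → - sumF (λ j → χ< q j * term₂ b a S q j))
        ≈⟨ +-cong refl (sym (-‿sumF {N} (λ q → sumF (λ j → χ< q j * term₂ b a S q j)))) ⟩
      orderedHalf a b S + (- orderedHalf b a S) ∎
      where
      N : ℕ
      N = suc (suc k)

  det-alternating : ∀ {m} → Alternating {suc m} {m} det
  det-alternating {zero} = lift tt
  det-alternating {suc m} =
      (λ a S → trans (DoubleExpansion.det-two-rows a a S) (-‿inverseʳ _))
    , (λ a b S → trans (DoubleExpansion.det-two-rows a b S) (trans (sym (⁻¹-anti-homo‿- (DoubleExpansion.orderedHalf b a S) (DoubleExpansion.orderedHalf a b S))) (-‿cong (sym (DoubleExpansion.det-two-rows b a S)))))
    , (λ x → Alternating-lincomb (λ j → sign (toℕ j) * x j) (λ j r → r ∘ punchIn j) (λ j → det) (λ j → det-alternating {m}))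

  alternating-repeated-row : ∀ {L m} (D : Rows L (suc m) → Carrier) → Alternating D → (S : Rows L m) (p : Fin m) → D (V.lookup S p ∷ S) ≈ 0#
  alternating-repeated-row {m = suc m} D (fa , fs , rest) (s ∷ S) zero = fa s S
  alternating-repeated-row {m = suc m} D (fa , fs , rest) (s ∷ S) (suc p) =
    trans (fs (V.lookup S p) s S) (trans (-‿cong (alternating-repeated-row (λ T → D (s ∷ T)) (rest s) S p)) -0#≈0#)

  Scaled : ∀ {L} → Fin L → Carrier → Row L → Row L → Set ℓ
  Scaled {L} j a r r' = (r' j ≈ (a * r j)) × (∀ i → i ≢ j → r' i ≈ r i)

  ScaledRows : ∀ {L m} → Fin L → Carrier → Rows L m → Rows L m → Set (c ⊔ ℓ)
  ScaledRows j a [] [] = Lift _ ⊤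
  ScaledRows j a (r ∷ S) (r' ∷ S') = Scaled j a r r' × ScaledRows j a S S'

  scaled-minor-at : ∀ {L m} (j : Fin (suc L)) a (S S' : Rows (suc L) m) → ScaledRows j a S S' →
    RowsEq (V.map (λ r → r ∘ punchIn j) S') (V.map (λ r → r ∘ punchIn j) S)
  scaled-minor-at j a [] [] e = lift tt
  scaled-minor-at j a (r ∷ S) (r' ∷ S') ((e1 , e2) , es) =
    (λ x → e2 (punchIn j x) (punchInᵢ≢i j x)) , scaled-minor-at j a S S' es

  scaled-minor-away : ∀ {L m} (l j : Fin (suc (suc L))) (ne : l ≢ j) a (S S' : Rows (suc (suc L)) m) → ScaledRows j a S S' →
    ScaledRows (punchOut′ l j) a (V.map (λ r → r ∘ punchIn l) S) (V.map (λ r → r ∘ punchIn l) S')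
  scaled-minor-away l j ne a [] [] e = lift tt
  scaled-minor-away l j ne a (r ∷ S) (r' ∷ S') ((e1 , e2) , es) =
    ( trans (reflexive (P.cong r' (punchIn-punchOut′ l j ne))) (trans e1 (*-cong refl (reflexive (P.cong r (P.sym (punchIn-punchOut′ l j ne))))))
    , (λ x nx → e2 (punchIn l x) (λ e → nx (P.trans (P.sym (punchOut′-punchIn l x)) (P.cong (punchOut′ l) e)))))
    , scaled-minor-away l j ne a S S' es

  det-scale-summand : ∀ {k} → (∀ (j : Fin (suc k)) a (S S' : Rows (suc k) (suc k)) → ScaledRows j a S S' → det S' ≈ (a * det S)) →
    ∀ (j : Fin (suc (suc k))) a r r' (S S' : Rows (suc (suc k)) (suc k)) → Scaled j a r r' → ScaledRows j a S S' → ∀ l →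
    ((sign (toℕ l) * r' l) * det (V.map (λ x → x ∘ punchIn l) S')) ≈ (a * ((sign (toℕ l) * r l) * det (V.map (λ x → x ∘ punchIn l) S)))
  det-scale-summand IH j a r r' S S' (e1 , e2) es l with l Fin.≟ j
  ... | yes P.refl = begin
        (sign (toℕ l) * r' l) * det (V.map (λ x → x ∘ punchIn l) S')
          ≈⟨ *-cong (*-cong refl e1) (det-cong _ _ (scaled-minor-at l a S S' es)) ⟩
        (sign (toℕ l) * (a * r l)) * det (V.map (λ x → x ∘ punchIn l) S)
          ≈⟨ *-cong (trans (sym (*-assoc _ _ _)) (trans (*-cong (*-comm _ _) refl) (*-assoc _ _ _))) refl ⟩
        (a * (sign (toℕ l) * r l)) * det (V.map (λ x → x ∘ punchIn l) S)
          ≈⟨ *-assoc _ _ _ ⟩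
        a * ((sign (toℕ l) * r l) * det (V.map (λ x → x ∘ punchIn l) S)) ∎
  ... | no ne = begin
        (sign (toℕ l) * r' l) * det (V.map (λ x → x ∘ punchIn l) S')
          ≈⟨ *-cong (*-cong refl (e2 l ne)) (IH (punchOut′ l j) a _ _ (scaled-minor-away l j ne a S S' es)) ⟩
        (sign (toℕ l) * r l) * (a * det (V.map (λ x → x ∘ punchIn l) S))
          ≈⟨ trans (sym (*-assoc _ _ _)) (trans (*-cong (*-comm _ _) refl) (*-assoc _ _ _)) ⟩
        a * ((sign (toℕ l) * r l) * det (V.map (λ x → x ∘ punchIn l) S)) ∎

  det-scale : ∀ {k} (j : Fin k) a (S S' : Rows k k) → ScaledRows j a S S' → det S' ≈ (a * det S)
  det-scale {suc zero} zero a (r ∷ []) (r' ∷ []) ((e1 , e2) , _) =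
    trans (+-cong (*-cong (*-cong refl e1) refl) refl)
      (trans (+-identityʳ _) (trans (*-cong (*-identityˡ _) refl) (trans (*-identityʳ _) (sym (*-cong refl (trans (+-identityʳ _) (trans (*-cong (*-identityˡ _) refl) (*-identityʳ _))))))))
  det-scale {suc (suc k)} j a (r ∷ S) (r' ∷ S') (e , es) =
    trans (sumF-cong {suc (suc k)} {λ l → (sign (toℕ l) * r' l) * det (V.map (λ x → x ∘ punchIn l) S')}
                     {λ l → a * ((sign (toℕ l) * r l) * det (V.map (λ x → x ∘ punchIn l) S))} (det-scale-summand (det-scale {suc k}) j a r r' S S' e es))
          (sym (*-distribˡ-sumF a (λ l → (sign (toℕ l) * r l) * det (V.map (λ x → x ∘ punchIn l) S))))

  zero-column-scaled : ∀ {L m} (j : Fin L) (S : Rows L m) → (∀ p → V.lookup S p j ≈ 0#) → ScaledRows j 0# S S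
  zero-column-scaled j [] h = lift tt
  zero-column-scaled j (r ∷ S) h = (trans (h zero) (sym (zeroˡ _)) , (λ i _ → refl)) , zero-column-scaled j S (λ p → h (suc p))

  det-zero-column : ∀ {k} (j : Fin k) (S : Rows k k) → (∀ p → V.lookup S p j ≈ 0#) → det S ≈ 0#
  det-zero-column j S h = trans (det-scale j 0# S S (zero-column-scaled j S h)) (zeroˡ _)

  -- AllSub k R P: P holds for every subsequence of k rows of R.
  AllSub : ∀ {L N} (k : ℕ) → Rows L N → (Rows L k → Set ℓ) → Set ℓ
  AllSub zero R P = P []
  AllSub (suc k) [] P = Lift _ ⊤
  AllSub (suc k) (r ∷ R) P = AllSub k R (λ S → P (r ∷ S)) × AllSub (suc k) R P

  AllSub-mono : ∀ {L N} k (R : Rows L N) {P Q : Rows L k → Set ℓ} → (∀ S → P S → Q S) → AllSub k R P → AllSub k R Q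
  AllSub-mono zero R f h = f [] h
  AllSub-mono (suc k) [] f h = lift tt
  AllSub-mono (suc k) (r ∷ R) f (h1 , h2) = AllSub-mono k R (λ S → f (r ∷ S)) h1 , AllSub-mono (suc k) R f h2

  AllSub-zipWith : ∀ {L N} k (R : Rows L N) {P Q W : Rows L k → Set ℓ} → (∀ S → P S → Q S → W S) → AllSub k R P → AllSub k R Q → AllSub k R W
  AllSub-zipWith zero R f h g = f [] h g
  AllSub-zipWith (suc k) [] f h g = lift tt
  AllSub-zipWith (suc k) (r ∷ R) f (h1 , h2) (g1 , g2) = AllSub-zipWith k R (λ S → f (r ∷ S)) h1 g1 , AllSub-zipWith (suc k) R f h2 g2

  AllSub-map : ∀ {L L' N} (f : Row L → Row L') k (R : Rows L N) {P : Rows L' k → Set ℓ} → AllSub k R (λ S → P (V.map f S)) → AllSub k (V.map f R) P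
  AllSub-map f zero R h = h
  AllSub-map f (suc k) [] h = lift tt
  AllSub-map f (suc k) (r ∷ R) (h1 , h2) = AllSub-map f k R h1 , AllSub-map f (suc k) R h2

  AllSub-vacuous : ∀ {L N} k (R : Rows L N) {P : Rows L k → Set ℓ} → N < k → AllSub k R P
  AllSub-vacuous (suc k) [] lt = lift tt
  AllSub-vacuous (suc k) (r ∷ R) (s≤s lt) = AllSub-vacuous k R lt , AllSub-vacuous (suc k) R (ℕP.m≤n⇒m≤1+n lt)

  AllSub-self : ∀ {L k} (R : Rows L k) {P : Rows L k → Set ℓ} → P R → AllSub k R P
  AllSub-self [] h = h
  AllSub-self {k = suc k} (r ∷ R) h = AllSub-self R h , AllSub-vacuous (suc k) R ℕP.≤-refl

  AllSub-cons : ∀ {L N} m (D : Rows L (suc m) → Carrier) → Alternating D → (R : Rows L N) →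
      AllSub (suc m) R (λ T → ¬ ¬ (D T ≈ 0#)) →
      AllSub m R (λ S → ∀ p → ¬ ¬ (D (V.lookup R p ∷ S) ≈ 0#))
  AllSub-cons zero D alt [] H = λ ()
  AllSub-cons (suc m) D alt [] H = lift tt
  AllSub-cons zero D alt (r0 ∷ R1) (H1 , H2) = λ { zero → H1 ; (suc p) → AllSub-cons zero D alt R1 H2 p }
  AllSub-cons {L} (suc m) D (fa , fs , rest) (r0 ∷ R1) (H1 , H2) = part1 , part2
    where
    part2 : AllSub (suc m) R1 (λ S → ∀ p → ¬ ¬ (D (V.lookup (r0 ∷ R1) p ∷ S) ≈ 0#))
    part2 = AllSub-zipWith (suc m) R1 (λ S h1 h2 → λ { zero → h1 ; (suc p) → h2 p }) H1 (AllSub-cons (suc m) D (fa , fs , rest) R1 H2)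
    part1 : AllSub m R1 (λ S1 → ∀ p → ¬ ¬ (D (V.lookup (r0 ∷ R1) p ∷ r0 ∷ S1) ≈ 0#))
    part1 = AllSub-mono m R1 (λ S1 h → λ { zero → λ k → k (fa r0 S1)
                                     ; (suc p) → λ k → h p (λ e → k (trans (fs _ r0 S1) (trans (-‿cong e) -0#≈0#))) })
                  (AllSub-cons m (λ T → D (r0 ∷ T)) (rest r0) R1 H1)

  ¬¬-pull-Fin : ∀ {N} {a} {P : Fin N → Set a} → (∀ p → ¬ ¬ (P p)) → ¬ ¬ (∀ p → P p)
  ¬¬-pull-Fin {zero} h k = k (λ ())
  ¬¬-pull-Fin {suc N} {P = P} h k = h zero (λ p0 → ¬¬-pull-Fin {N} {P = P ∘ suc} (h ∘ suc) (λ rest → k (λ { zero → p0 ; (suc p) → rest p })))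

  dot : ∀ {L} → Row L → Row L → Carrier
  dot r a = sumF (λ j → r j * a j)

  -- Stated with ¬ ¬ because ≈ is not decidable.
  Independent : ∀ {L N} → Rows L N → Set (c ⊔ ℓ)
  Independent {L} R = ∀ (a : Row L) → (∀ p → dot (V.lookup R p) a ≈ 0#) → ∀ j → ¬ ¬ (a j ≈ 0#)

  cofactors : ∀ {k} → Rows (suc k) k → Row (suc k)
  cofactors S j = sign (toℕ j) * det (V.map (λ r → r ∘ punchIn j) S)

  det≈dot-cofactors : ∀ {k} (r : Row (suc k)) (S : Rows (suc k) k) → det (r ∷ S) ≈ dot r (cofactors S)
  det≈dot-cofactors {k} r S = sumF-cong {suc k} {λ j → (sign (toℕ j) * r j) * det (V.map (λ x → x ∘ punchIn j) S)} {λ j → r j * cofactors S j}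
                      (λ j → trans (*-cong (*-comm _ _) refl) (*-assoc _ _ _))

  -- If all k-row minors of R vanished, the cofactors of every (k−1)-row subsequence would be
  -- orthogonal to all rows, so by independence their first entry, the corresponding minor of the
  -- remaining columns, would vanish; induct down to the empty determinant 1.
  independent⇒¬allMinors≈0 : ∀ k {N} (R : Rows k N) → Independent R → ¬ AllSub k R (λ S → ¬ ¬ (det S ≈ 0#))
  independent⇒¬allMinors≈0 zero R ind H = H (λ e → 1≉0 e)
  independent⇒¬allMinors≈0 (suc k) {N} R ind H = independent⇒¬allMinors≈0 k R' ind' H'
    where
    R' : Rows k N
    R' = V.map (λ r → r ∘ suc) R
    G : AllSub k R (λ S → ∀ p → ¬ ¬ (det (V.lookup R p ∷ S) ≈ 0#))
    G = AllSub-cons k det det-alternating R H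
    step : ∀ S → (∀ p → ¬ ¬ (det (V.lookup R p ∷ S) ≈ 0#)) → ¬ ¬ (det (V.map (λ r → r ∘ suc) S) ≈ 0#)
    step S h = λ k0 → ¬¬-pull-Fin (λ p k1 → h p (λ e → k1 (trans (sym (det≈dot-cofactors (V.lookup R p) S)) e)))
                 (λ all → ind (cofactors S) all zero (λ e → k0 (trans (sym (*-identityˡ _)) e)))
    H' : AllSub k R' (λ S' → ¬ ¬ (det S' ≈ 0#))
    H' = AllSub-map (λ r → r ∘ suc) k R (AllSub-mono k R step G)
    ind' : Independent R'
    ind' a' h j = ind a (λ p → trans (+-cong (zeroʳ _) refl) (trans (+-identityˡ _)
                     (trans (sumF-cong {k} {λ j → V.lookup R p (suc j) * a' j} {λ j → V.lookup R' p j * a' j}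
                        (λ j → *-cong (reflexive (P.cong (λ r → r j) (P.sym (lookup-map p (λ r → r ∘ suc) R)))) refl)) (h p)))) (suc j)
      where
      a : Row (suc k)
      a zero = 0#
      a (suc j) = a' j

  independent⇒det≉0 : ∀ {k} (R : Rows k k) → Independent R → ¬ (det R ≈ 0#)
  independent⇒det≉0 {k} R ind e = independent⇒¬allMinors≈0 k R ind (AllSub-self R (λ k0 → k0 e))

  -- The polynomials τᵢ

  tauGen-suc : ∀ {m} (θ : Fin m → Carrier) X (i : Fin m) v →
               (tauGen θ X (suc i) · v) ≈ᵥ (shift X (θ i) · (tauGen θ X (inject₁ i) · v))
  tauGen-suc {suc m} θ X zero v = *ₘ-· (shift X (θ zero)) Iₘ v
  tauGen-suc {suc m} θ X (suc i) v =
    ≈ᵥ-trans (*ₘ-· S₀ (tauGen (θ ∘ suc) X (suc i)) v)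
    (≈ᵥ-trans (·-cong {S₀} (λ _ _ → refl) (tauGen-suc (θ ∘ suc) X i v))
    (≈ᵥ-trans (shift-·-comm X (θ zero) (θ (suc i)) (tauGen (θ ∘ suc) X (inject₁ i) · v))
              (·-cong {shift X (θ (suc i))} (λ _ _ → refl) (≈ᵥ-sym (*ₘ-· S₀ (tauGen (θ ∘ suc) X (inject₁ i)) v)))))
    where
    S₀ : Mat
    S₀ = shift X (θ zero)

  tau-suc : ∀ (θ : Fin n → Carrier) X (i : Fin d) v →
    (tau θ X (suc i) · v) ≈ᵥ (shift X (θ (inject₁ i)) · (tau θ X (inject₁ i) · v))
  tau-suc θ X i v = tauGen-suc θ X (inject₁ i) v

  tau-zero : ∀ (θ : Fin n → Carrier) X v → (tau θ X zero · v) ≈ᵥ v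
  tau-zero θ X v = Iₘ-· v

  shiftedProd : ∀ {m} → (Fin m → Carrier) → Carrier → Fin (suc m) → Carrier
  shiftedProd θ μ zero = 1#
  shiftedProd {suc m} θ μ (suc i) = (μ - θ zero) * shiftedProd (λ k → θ (suc k)) μ i

  shiftedProd-zero : ∀ {m} (θ : Fin m → Carrier) μ (j : Fin (suc m)) (l : Fin m) → toℕ l < toℕ j → μ ≈ θ l → shiftedProd θ μ j ≈ 0#
  shiftedProd-zero {suc m} θ μ (suc j) zero lt e = trans (*-cong (x≈y⇒x∙y⁻¹≈ε e) refl) (zeroˡ _)
  shiftedProd-zero {suc m} θ μ (suc j) (suc l) (s≤s lt) e = trans (*-cong refl (shiftedProd-zero (λ k → θ (suc k)) μ j l lt e)) (zeroʳ _)

  shiftedProd-≉0 : ∀ {m} (θ : Fin m → Carrier) μ (j : Fin (suc m)) → (∀ (l : Fin m) → toℕ l < toℕ j → ¬ (μ ≈ θ l)) → (shiftedProd θ μ j ≉ 0#)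
  shiftedProd-≉0 θ μ zero h = 1≉0
  shiftedProd-≉0 {suc m} θ μ (suc j) h = *-preserves-≉0 (x≉y⇒x-y≉0 (h zero (s≤s z≤n))) (shiftedProd-≉0 (λ k → θ (suc k)) μ j (λ l lt → h (suc l) (s≤s lt)))

  transposeRows : (Fin n → Vec) → Rows n n
  transposeRows b = V.tabulate (λ i j → b j i)

  lookup-tabulate : ∀ {L m} (g : Fin m → Row L) (p : Fin m) (j : Fin L) → V.lookup (V.tabulate g) p j ≈ g p j
  lookup-tabulate g p j = reflexive (P.cong (λ r → r j) (lookup∘tabulate g p))

  tabulate-scaled : ∀ {L m} (j : Fin L) a (f g : Fin m → Row L) → (∀ i → Scaled j a (f i) (g i)) →
                    ScaledRows j a (V.tabulate f) (V.tabulate g)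
  tabulate-scaled {m = zero} j a f g h = lift tt
  tabulate-scaled {m = suc m} j a f g h = h zero , tabulate-scaled j a (f ∘ suc) (g ∘ suc) (h ∘ suc)

  map-tabulate : ∀ {L L' m} (f : Row L → Row L') (g : Fin m → Row L) → RowsEq (V.map f (V.tabulate g)) (V.tabulate (f ∘ g))
  map-tabulate {m = zero} f g = lift tt
  map-tabulate {m = suc m} f g = (λ j → refl) , map-tabulate f (g ∘ suc)

  -- The coordinate matrix of b has independent rows, hence a nonzero determinant.  Independence of b
  -- then follows by scaling a column, and spanning from the cofactor expansion of [v | b], whose
  -- repeated rows make every cofactor relation vanish (Cramer's rule).
  module _ (b : Fin n → Vec) (b≉0 : ∀ i → ¬ (b i ≈ᵥ 0ᵥ))
           (direct : ∀ (a : Fin n → Carrier) → vsum (λ i → a i • b i) ≈ᵥ 0ᵥ → ∀ i → (a i • b i) ≈ᵥ 0ᵥ) where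
    private
      B : Rows n n
      B = transposeRows b

      B-independent : Independent B
      B-independent a h j a≉0 = b≉0 j (•≈0ᵥ⇒≈0ᵥ a≉0 (direct a (λ i → trans (sumF-cong {n} {λ k → a k * b k i} {λ k → V.lookup B i k * a k}
        (λ k → trans (*-comm _ _) (*-cong (sym (lookup-tabulate (λ i' j' → b j' i') i k)) refl))) (h i)) j))

      det-B≉0 : ¬ (det B ≈ 0#)
      det-B≉0 = independent⇒det≉0 B B-independent

      scaleColumn : Fin n → Carrier → Fin n → Row n
      scaleColumn j a i l with l Fin.≟ j
      ... | yes _ = a * b j i
      ... | no _ = b l i

      scaleColumn-at : ∀ j a i → scaleColumn j a i j ≈ a * b j i
      scaleColumn-at j a i with j Fin.≟ j
      ... | yes _ = refl
      ... | no ne = ⊥-elim (ne P.refl)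

      scaleColumn-away : ∀ j a i l → l ≢ j → scaleColumn j a i l ≈ b l i
      scaleColumn-away j a i l ne with l Fin.≟ j
      ... | yes e = ⊥-elim (ne e)
      ... | no _ = refl

      independent : ∀ (a : Fin n → Carrier) → vsum (λ i → a i • b i) ≈ᵥ 0ᵥ → ∀ j → a j ≈ 0#
      independent a h j = x*y≈0⇒y≈0 det-B≉0
        (trans (*-comm _ _) (trans (sym (det-scale j (a j) B B′ B′-scaled)) (det-zero-column j B′ B′-column≈0)))
        where
        B′ : Rows n n
        B′ = V.tabulate (scaleColumn j (a j))
        B′-scaled : ScaledRows j (a j) B B′
        B′-scaled = tabulate-scaled j (a j) (λ i l → b l i) (scaleColumn j (a j))
                      (λ i → scaleColumn-at j (a j) i , scaleColumn-away j (a j) i)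
        B′-column≈0 : ∀ p → V.lookup B′ p j ≈ 0#
        B′-column≈0 p = trans (lookup-tabulate (scaleColumn j (a j)) p j) (trans (scaleColumn-at j (a j) p) (direct a h j p))

      module Spanning (v : Vec) where
        Bᵥ : Rows (suc n) n
        Bᵥ = V.tabulate (λ i → v i VF.∷ (λ j → b j i))

        cof : Row (suc n)
        cof = cofactors Bᵥ

        cof₀≉0 : cof zero ≉ 0#
        cof₀≉0 e = det-B≉0 (trans (sym (trans (*-identityˡ _) (det-cong _ _ (map-tabulate (λ r → r ∘ suc) (λ i → v i VF.∷ (λ j → b j i)))))) e)

        coeff : Fin n → Carrier
        coeff l = (- inv cof₀≉0) * cof (suc l)

        cofactor-relation : ∀ i → (v i * cof zero) + sumF (λ l → b l i * cof (suc l)) ≈ 0#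
        cofactor-relation i = begin
          (v i * cof zero) + sumF (λ l → b l i * cof (suc l))
            ≈⟨ +-cong (*-cong (sym (lookup-tabulate (λ i' → v i' VF.∷ (λ j → b j i')) i zero)) refl)
                      (sumF-cong {n} {λ l → b l i * cof (suc l)} {λ l → V.lookup Bᵥ i (suc l) * cof (suc l)} (λ l → *-cong (sym (lookup-tabulate (λ i' → v i' VF.∷ (λ j → b j i')) i (suc l))) refl)) ⟩
          dot (V.lookup Bᵥ i) cof       ≈⟨ sym (det≈dot-cofactors (V.lookup Bᵥ i) Bᵥ) ⟩
          det (V.lookup Bᵥ i ∷ Bᵥ)      ≈⟨ alternating-repeated-row det det-alternating Bᵥ i ⟩
          0# ∎

        expansion : v ≈ᵥ vsum (λ l → coeff l • b l)
        expansion i = begin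
          v i                                   ≈⟨ sym (*-identityʳ _) ⟩
          v i * 1#                              ≈⟨ *-cong refl (sym (inv-inverseʳ cof₀≉0)) ⟩
          v i * (cof zero * inv cof₀≉0)         ≈⟨ sym (*-assoc _ _ _) ⟩
          (v i * cof zero) * inv cof₀≉0         ≈⟨ *-cong (+-inverseˡ-unique _ _ (cofactor-relation i)) refl ⟩
          (- S) * inv cof₀≉0                    ≈⟨ trans (sym (-‿distribˡ-* _ _)) (trans (-‿cong (*-comm _ _)) (-‿distribˡ-* _ _)) ⟩
          (- inv cof₀≉0) * S                    ≈⟨ *-distribˡ-sumF (- inv cof₀≉0) (λ l → b l i * cof (suc l)) ⟩
          sumF (λ l → (- inv cof₀≉0) * (b l i * cof (suc l)))
            ≈⟨ sumF-cong {n} {λ l → (- inv cof₀≉0) * (b l i * cof (suc l))} {λ l → coeff l * b l i}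
                 (λ l → trans (*-cong refl (*-comm _ _)) (sym (*-assoc _ _ _))) ⟩
          sumF (λ l → coeff l * b l i) ∎
          where
          S : Carrier
          S = sumF (λ l → b l i * cof (suc l))

    direct⇒isBasis : IsBasis b
    direct⇒isBasis = independent , (λ v → Spanning.coeff v , Spanning.expansion v)

  module Basis (b : Fin n → Vec) (isBasis : IsBasis b) where
    independent : ∀ (a : Fin n → Carrier) → vsum (λ i → a i • b i) ≈ᵥ 0ᵥ → ∀ i → a i ≈ 0#
    independent = proj₁ isBasis

    coord : Vec → Fin n → Carrier
    coord v = proj₁ (proj₂ isBasis v)

    expansion : ∀ v → v ≈ᵥ vsum (λ l → coord v l • b l)
    expansion v = proj₂ (proj₂ isBasis v)

    lincomb-injective : ∀ (a a' : Fin n → Carrier) →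
                        vsum (λ l → a l • b l) ≈ᵥ vsum (λ l → a' l • b l) → ∀ l → a l ≈ a' l
    lincomb-injective a a' h l =
      x∙y⁻¹≈ε⇒x≈y _ _ (independent (λ l → a l - a' l) (≈ᵥ-trans (lincomb--ᵥ a a' b) (u≈v⇒u-v≈0 h)) l)

    coord-unique : ∀ v (a : Fin n → Carrier) → v ≈ᵥ vsum (λ l → a l • b l) → ∀ l → a l ≈ coord v l
    coord-unique v a h = lincomb-injective a (coord v) (≈ᵥ-trans (≈ᵥ-sym h) (expansion v))

    lincomb-single : ∀ k x → vsum (λ l → (Iₘ l k * x) • b l) ≈ᵥ (x • b k)
    lincomb-single k x = ≈ᵥ-trans (vsum-single (λ l → (Iₘ l k * x) • b l) k
        (λ l ne → ≈ᵥ-trans (•-cong {v = b l} (trans (*-cong (Iₘ-offDiag l k ne) refl) (zeroˡ _)) ≈ᵥ-refl) (0#-• _)))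
      (•-cong {v = b k} (trans (*-cong (Iₘ-diag k) refl) (*-identityˡ _)) ≈ᵥ-refl)

    •-basis≈0⇒≈0 : ∀ k x → (x • b k) ≈ᵥ 0ᵥ → x ≈ 0#
    •-basis≈0⇒≈0 k x e = trans (sym (trans (*-cong (Iₘ-diag k) refl) (*-identityˡ _)))
      (independent (λ l → Iₘ l k * x) (≈ᵥ-trans (lincomb-single k x) e) k)

    basis≉0 : ∀ i → ¬ (b i ≈ᵥ 0ᵥ)
    basis≉0 i e = 1≉0 (•-basis≈0⇒≈0 i 1# (≈ᵥ-trans (1#-• (b i)) e))

    coord-cong : ∀ {u v} → u ≈ᵥ v → ∀ k → coord u k ≈ coord v k
    coord-cong {u} {v} e = coord-unique v (coord u) (≈ᵥ-trans (≈ᵥ-sym e) (expansion u))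

    coord-basis : ∀ j k → coord (b j) k ≈ Iₘ k j
    coord-basis j k = trans (sym (coord-unique (b j) (λ l → Iₘ l j * 1#)
      (≈ᵥ-sym (≈ᵥ-trans (lincomb-single j 1#) (1#-• (b j)))) k)) (*-identityʳ _)

    coord-lincomb : ∀ {m} (a : Fin m → Carrier) (v : Fin m → Vec) k →
                    coord (vsum (λ l → a l • v l)) k ≈ sumF (λ l → a l * coord (v l) k)
    coord-lincomb {m} a v k = sym (coord-unique (vsum (λ l → a l • v l)) (λ k' → sumF (λ l → a l * coord (v l) k')) ex k)
      where
      ex : vsum (λ l → a l • v l) ≈ᵥ vsum (λ k' → sumF (λ l → a l * coord (v l) k') • b k')
      ex r = begin
        sumF (λ l → a l * v l r)
          ≈⟨ sumF-cong {m} (λ l → trans (*-cong refl (expansion (v l) r)) (*-distribˡ-sumF (a l) (λ k' → coord (v l) k' * b k' r))) ⟩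
        sumF (λ l → sumF (λ k' → a l * (coord (v l) k' * b k' r)))
          ≈⟨ sumF-comm {m} {n} (λ l k' → a l * (coord (v l) k' * b k' r)) ⟩
        sumF (λ k' → sumF (λ l → a l * (coord (v l) k' * b k' r)))
          ≈⟨ sumF-cong {n} (λ k' → trans (sumF-cong {m} (λ l → sym (*-assoc _ _ _)))
                                        (sym (*-distribʳ-sumF (b k' r) (λ l → a l * coord (v l) k')))) ⟩
        sumF (λ k' → sumF (λ l → a l * coord (v l) k') * b k' r) ∎

    coord-• : ∀ x v k → coord (x • v) k ≈ x * coord v k
    coord-• x v k = sym (coord-unique (x • v) (λ l → x * coord v l)
      (≈ᵥ-trans (•-cong {x} refl (expansion v)) (•-lincomb x (coord v) b)) k)

    coord--ᵥ• : ∀ u x w k → coord (u -ᵥ (x • w)) k ≈ coord u k - x * coord w k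
    coord--ᵥ• u x w k = sym (coord-unique (u -ᵥ (x • w)) (λ k' → coord u k' - x * coord w k')
      (≈ᵥ-trans (λ r → +-cong (expansion u r) (-‿cong (trans (*-cong refl (expansion w r)) (•-lincomb x (coord w) b r))))
                (≈ᵥ-sym (lincomb--ᵥ (coord u) (λ k' → x * coord w k') b))) k)

    coord-0ᵥ : ∀ k → coord 0ᵥ k ≈ 0#
    coord-0ᵥ k = sym (coord-unique 0ᵥ (λ _ → 0#) (λ r → sym (sumF-zero {n} (λ l → 0# * b l r) (λ l → zeroˡ _))) k)

    coord-· : ∀ (M : Mat) v k → coord (M · v) k ≈ sumF (λ l → coord v l * coord (M · b l) k)
    coord-· M v k = trans (coord-cong (≈ᵥ-trans (·-cong {M} (λ _ _ → refl) (expansion v)) (·-lincomb M (coord v) b)) k)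
                          (coord-lincomb (coord v) (λ l → M · b l) k)

    coord-shift· : ∀ (M : Mat) μ v k → coord (shift M μ · v) k ≈ coord (M · v) k - μ * coord v k
    coord-shift· M μ v k = trans (coord-cong (shift-· M μ v) k) (coord--ᵥ• (M · v) μ v k)

    decomposition : IsDecomposition (λ i → span1 (b i))
    decomposition = (λ i → b i , basis≉0 i , (λ _ h → h) , (λ _ h → h))
                  , (λ v → (λ i → coord v i • b i) , (λ i → coord v i , ≈ᵥ-refl) , expansion v)
                  , λ u u' u∈ u'∈ Σu≈Σu' i → ≈ᵥ-trans (proj₂ (u∈ i)) (≈ᵥ-trans (•-cong {v = b i}
                      (lincomb-injective (λ l → proj₁ (u∈ l)) (λ l → proj₁ (u'∈ l))
                        (≈ᵥ-trans (vsum-cong (λ l → ≈ᵥ-sym (proj₂ (u∈ l)))) (≈ᵥ-trans Σu≈Σu' (vsum-cong (λ l → proj₂ (u'∈ l))))) i)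
                      ≈ᵥ-refl) (≈ᵥ-sym (proj₂ (u'∈ i))))

    coord≈0⇒≈0ᵥ : ∀ v → (∀ k → coord v k ≈ 0#) → v ≈ᵥ 0ᵥ
    coord≈0⇒≈0ᵥ v h = ≈ᵥ-trans (expansion v)
      (vsum-zero (λ l → coord v l • b l) (λ l → ≈ᵥ-trans (•-cong {v = b l} (h l) ≈ᵥ-refl) (0#-• _)))

  -- Eigenvectors and primitive idempotents

  prodF : ∀ {m} → (Fin m → Carrier) → Carrier
  prodF {zero} f = 1#
  prodF {suc m} f = f zero * prodF (f ∘ suc)

  prodF-≉0 : ∀ {m} (f : Fin m → Carrier) → (∀ k → (f k ≉ 0#)) → (prodF f ≉ 0#)
  prodF-≉0 {zero} f h = 1≉0
  prodF-≉0 {suc m} f h = *-preserves-≉0 (h zero) (prodF-≉0 (f ∘ suc) (h ∘ suc))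

  prodF-zero : ∀ {m} (f : Fin m → Carrier) k → f k ≈ 0# → prodF f ≈ 0#
  prodF-zero {suc m} f zero e = trans (*-cong e refl) (zeroˡ _)
  prodF-zero {suc m} f (suc k) e = trans (*-cong refl (prodF-zero (f ∘ suc) k e)) (zeroʳ _)

  applyShifts : ∀ {m} → Mat → (Fin m → Carrier) → Vec → Vec
  applyShifts {zero} X μ v = v
  applyShifts {suc m} X μ v = shift X (μ zero) · applyShifts X (μ ∘ suc) v

  applyShifts-cong : ∀ {m} X (μ : Fin m → Carrier) {u v} → u ≈ᵥ v → applyShifts X μ u ≈ᵥ applyShifts X μ v
  applyShifts-cong {zero} X μ e = e
  applyShifts-cong {suc m} X μ e = ·-cong {shift X (μ zero)} (λ i j → refl) (applyShifts-cong X (μ ∘ suc) e)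

  applyShifts-• : ∀ {m} X (μ : Fin m → Carrier) a v → applyShifts X μ (a • v) ≈ᵥ (a • applyShifts X μ v)
  applyShifts-• {zero} X μ a v = ≈ᵥ-refl
  applyShifts-• {suc m} X μ a v = ≈ᵥ-trans (·-cong {shift X (μ zero)} (λ i j → refl) (applyShifts-• X (μ ∘ suc) a v)) (·-• (shift X (μ zero)) a (applyShifts X (μ ∘ suc) v))

  applyShifts-0ᵥ : ∀ {m} X (μ : Fin m → Carrier) → applyShifts X μ 0ᵥ ≈ᵥ 0ᵥ
  applyShifts-0ᵥ {zero} X μ = ≈ᵥ-refl
  applyShifts-0ᵥ {suc m} X μ = ≈ᵥ-trans (·-cong {shift X (μ zero)} (λ i j → refl) (applyShifts-0ᵥ X (μ ∘ suc))) (·-0ᵥ (shift X (μ zero)))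

  applyShifts--ᵥ : ∀ {m} X (μ : Fin m → Carrier) u v → applyShifts X μ (u -ᵥ v) ≈ᵥ (applyShifts X μ u -ᵥ applyShifts X μ v)
  applyShifts--ᵥ {zero} X μ u v = ≈ᵥ-refl
  applyShifts--ᵥ {suc m} X μ u v = ≈ᵥ-trans (·-cong {shift X (μ zero)} (λ i j → refl) (applyShifts--ᵥ X (μ ∘ suc) u v)) (·--ᵥ (shift X (μ zero)) (applyShifts X (μ ∘ suc) u) (applyShifts X (μ ∘ suc) v))

  applyShifts-vsum : ∀ {m k} X (μ : Fin m → Carrier) (u : Fin k → Vec) → applyShifts X μ (vsum u) ≈ᵥ vsum (λ j → applyShifts X μ (u j))
  applyShifts-vsum {zero} X μ u = ≈ᵥ-refl
  applyShifts-vsum {suc m} X μ u = ≈ᵥ-trans (·-cong {shift X (μ zero)} (λ i j → refl) (applyShifts-vsum X (μ ∘ suc) u)) (·-vsum (shift X (μ zero)) (λ j → applyShifts X (μ ∘ suc) (u j)))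

  applyShifts-eigen : ∀ {m} X (μ : Fin m → Carrier) {λ' u} → InEigenspace X λ' u → applyShifts X μ u ≈ᵥ (prodF (λ k → λ' - μ k) • u)
  applyShifts-eigen {zero} X μ e i = sym (*-identityˡ _)
  applyShifts-eigen {suc m} X μ {λ'} {u} e = ≈ᵥ-trans (·-cong {shift X (μ zero)} (λ i j → refl) (applyShifts-eigen X (μ ∘ suc) e))
     (≈ᵥ-trans (shift-·-eigen {X} {λ'} (μ zero) (InEigenspace-• {X} {λ'} {u} (prodF (λ k → λ' - μ (suc k))) e)) (λ i → sym (*-assoc _ _ _)))

  applyShifts-annihilates : ∀ {m} X (μ : Fin m → Carrier) (u : Fin m → Vec) → (∀ k → InEigenspace X (μ k) (u k)) → applyShifts X μ (vsum u) ≈ᵥ 0ᵥ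
  applyShifts-annihilates {m} X μ u h = ≈ᵥ-trans (applyShifts-vsum X μ u)
    (vsum-zero (λ k → applyShifts X μ (u k)) (λ k → ≈ᵥ-trans (applyShifts-eigen X μ {μ k} {u k} (h k))
        (≈ᵥ-trans (•-cong {v = u k} (prodF-zero (λ l → μ k - μ l) k (-‿inverseʳ (μ k))) ≈ᵥ-refl) (0#-• (u k)))))

  -- Π(X − μₖ) and then Π(X − μ′ₖ) annihilate both sums and scale w by nonzero products.
  eigen∈otherDiff⇒≈0 : ∀ {X θ w} {m m'} (μ : Fin m → Carrier) (u : Fin m → Vec) (μ' : Fin m' → Carrier) (u' : Fin m' → Vec) →
        InEigenspace X θ w → (∀ k → ¬ (μ k ≈ θ)) → (∀ k → InEigenspace X (μ k) (u k)) →
        (∀ k → ¬ (μ' k ≈ θ)) → (∀ k → InEigenspace X (μ' k) (u' k)) → w ≈ᵥ (vsum u -ᵥ vsum u') → w ≈ᵥ 0ᵥ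
  eigen∈otherDiff⇒≈0 {X} {θ} {w} μ u μ' u' w-eigen μ≉θ u-eigen μ′≉θ u′-eigen w≈ = •≈0ᵥ⇒≈0ᵥ π≉0 (•≈0ᵥ⇒≈0ᵥ π′≉0 (≈ᵥ-trans (≈ᵥ-sym w-scaled) w-image²≈0))
    where
    π : Carrier
    π = prodF (λ k → θ - μ k)
    π′ : Carrier
    π′ = prodF (λ k → θ - μ' k)
    π≉0 : (π ≉ 0#)
    π≉0 = prodF-≉0 _ (λ k → x≉y⇒x-y≉0 (λ e → μ≉θ k (sym e)))
    π′≉0 : (π′ ≉ 0#)
    π′≉0 = prodF-≉0 _ (λ k → x≉y⇒x-y≉0 (λ e → μ′≉θ k (sym e)))
    w-scaled : applyShifts X μ' (applyShifts X μ w) ≈ᵥ (π′ • (π • w))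
    w-scaled = ≈ᵥ-trans (applyShifts-cong X μ' (applyShifts-eigen X μ {θ} {w} w-eigen)) (applyShifts-eigen X μ' {θ} {π • w} (InEigenspace-• {X} {θ} {w} π w-eigen))
    cross : Fin _ → Carrier
    cross k = prodF (λ l → μ' k - μ l)
    u′-image : applyShifts X μ (vsum u') ≈ᵥ vsum (λ k → cross k • u' k)
    u′-image = ≈ᵥ-trans (applyShifts-vsum X μ u') (vsum-cong (λ k → applyShifts-eigen X μ {μ' k} {u' k} (u′-eigen k)))
    cross-image≈0 : applyShifts X μ' (vsum (λ k → cross k • u' k)) ≈ᵥ 0ᵥ
    cross-image≈0 = ≈ᵥ-trans (applyShifts-vsum X μ' (λ k → cross k • u' k)) (vsum-zero (λ k → applyShifts X μ' (cross k • u' k)) (λ k → ≈ᵥ-trans (applyShifts-• X μ' (cross k) (u' k))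
               (≈ᵥ-trans (•-cong {cross k} {cross k} refl (≈ᵥ-trans (applyShifts-eigen X μ' {μ' k} {u' k} (u′-eigen k))
                    (≈ᵥ-trans (•-cong {v = u' k} (prodF-zero (λ l → μ' k - μ' l) k (-‿inverseʳ (μ' k))) ≈ᵥ-refl) (0#-• (u' k))))) (•-0ᵥ (cross k)))))
    w-image : applyShifts X μ w ≈ᵥ (applyShifts X μ (vsum u) -ᵥ applyShifts X μ (vsum u'))
    w-image = ≈ᵥ-trans (applyShifts-cong X μ w≈) (applyShifts--ᵥ X μ (vsum u) (vsum u'))
    w-image≈ : (applyShifts X μ (vsum u) -ᵥ applyShifts X μ (vsum u')) ≈ᵥ (0ᵥ -ᵥ vsum (λ k → cross k • u' k))
    w-image≈ i = +-cong (applyShifts-annihilates X μ u u-eigen i) (-‿cong (u′-image i))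
    w-image²≈0 : applyShifts X μ' (applyShifts X μ w) ≈ᵥ 0ᵥ
    w-image²≈0 = ≈ᵥ-trans (applyShifts-cong X μ' (≈ᵥ-trans w-image w-image≈))
         (≈ᵥ-trans (applyShifts--ᵥ X μ' 0ᵥ (vsum (λ k → cross k • u' k)))
         (λ i → trans (+-cong (applyShifts-0ᵥ X μ' i) (-‿cong (cross-image≈0 i))) (trans (+-identityˡ _) -0#≈0#)))

  eigen∈others⇒≈0 : ∀ {X θ w} {m} (μ : Fin m → Carrier) (u : Fin m → Vec) →
        InEigenspace X θ w → (∀ k → ¬ (μ k ≈ θ)) → (∀ k → InEigenspace X (μ k) (u k)) → w ≈ᵥ vsum u → w ≈ᵥ 0ᵥ
  eigen∈others⇒≈0 {X} μ u ew nμ eu hw = eigen∈otherDiff⇒≈0 {X} {m' = zero} μ u (λ ()) (λ ()) ew nμ eu (λ ()) (λ ()) (λ i → trans (hw i) (sym (trans (+-cong refl -0#≈0#) (+-identityʳ _))))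

  module PrimitiveIdempotents (X : Mat) (E : Fin n → Mat) (θ : Fin n → Carrier)
                              (ordering : IsOrdering X E) (XE : ∀ i → (X *ₘ E i) ≈ₘ (θ i •ₘ E i)) where
    isPrimitive : ∀ i → IsPrimitiveIdempotent X (E i)
    isPrimitive = proj₁ ordering

    θ′ : Fin n → Carrier
    θ′ i = proj₁ (isPrimitive i)

    eigvec : Fin n → Vec
    eigvec i = proj₁ (proj₁ (proj₂ (isPrimitive i)))

    eigvec≉0 : ∀ i → ¬ (eigvec i ≈ᵥ 0ᵥ)
    eigvec≉0 i = proj₁ (proj₂ (proj₁ (proj₂ (isPrimitive i))))

    eigvec-θ′ : ∀ i → InEigenspace X (θ′ i) (eigvec i)
    eigvec-θ′ i = proj₂ (proj₂ (proj₁ (proj₂ (isPrimitive i))))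

    E-·-θ′ : ∀ i v → InEigenspace X (θ′ i) (E i · v)
    E-·-θ′ i = proj₁ (proj₂ (proj₂ (isPrimitive i)))

    E-complement : ∀ i v → InOtherEigenspaces X (θ′ i) (v -ᵥ (E i · v))
    E-complement i = proj₂ (proj₂ (proj₂ (isPrimitive i)))

    E-eigvec : ∀ i → (E i · eigvec i) ≈ᵥ eigvec i
    E-eigvec i with E-complement i (eigvec i)
    ... | (m , μ , u , μ≉θ′ , u-eigen , hw) = ≈ᵥ-sym (u-v≈0⇒u≈v (eigen∈others⇒≈0 {X} {θ′ i} μ u
          (InEigenspace--ᵥ X (θ′ i) _ _ (eigvec-θ′ i) (E-·-θ′ i (eigvec i))) μ≉θ′ u-eigen hw))

    eigvec-eigen : ∀ i → InEigenspace X (θ i) (eigvec i)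
    eigvec-eigen i j = begin
      (X · eigvec i) j              ≈⟨ ·-cong {X} {X} (λ _ _ → refl) (≈ᵥ-sym (E-eigvec i)) j ⟩
      (X · (E i · eigvec i)) j      ≈⟨ sym (*ₘ-· X (E i) (eigvec i) j) ⟩
      ((X *ₘ E i) · eigvec i) j     ≈⟨ ·-cong {X *ₘ E i} {θ i •ₘ E i} {eigvec i} (XE i) ≈ᵥ-refl j ⟩
      ((θ i •ₘ E i) · eigvec i) j   ≈⟨ •ₘ-· (θ i) (E i) (eigvec i) j ⟩
      θ i * (E i · eigvec i) j      ≈⟨ *-cong refl (E-eigvec i j) ⟩
      θ i * eigvec i j ∎

    θ′≈θ : ∀ i → ¬ ¬ (θ′ i ≈ θ i)
    θ′≈θ i θ′≉θ = eigvec≉0 i (•≈0ᵥ⇒≈0ᵥ (x≉y⇒x-y≉0 θ′≉θ) (λ j → trans (distribʳ (eigvec i j) (θ′ i) (- θ i))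
      (trans (+-cong (sym (eigvec-θ′ i j)) (trans (sym (-‿distribˡ-* _ _)) (-‿cong (sym (eigvec-eigen i j))))) (-‿inverseʳ _))))

    θ′-injective : ∀ i j → θ′ i ≈ θ′ j → E i ≈ₘ E j
    θ′-injective i j e = ·-ext λ v → E·-agree v (E-complement j v) (E-complement i v)
      where
      a-q-[a-p]≈p-q : ∀ a p q → (a - q) - (a - p) ≈ p - q
      a-q-[a-p]≈p-q a p q = begin
        (a - q) - (a - p)      ≈⟨ +-cong refl (⁻¹-anti-homo‿- a p) ⟩
        (a - q) + (p - a)      ≈⟨ +-comm _ _ ⟩
        (p - a) + (a - q)      ≈⟨ +-assoc p (- a) (a - q) ⟩
        p + (- a + (a - q))    ≈⟨ +-cong refl (sym (+-assoc (- a) a (- q))) ⟩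
        p + ((- a + a) - q)    ≈⟨ +-cong refl (+-cong (-‿inverseˡ a) refl) ⟩
        p + (0# - q)           ≈⟨ +-cong refl (+-identityˡ _) ⟩
        p - q ∎
      E·-agree : ∀ v → InOtherEigenspaces X (θ′ j) (v -ᵥ (E j · v)) → InOtherEigenspaces X (θ′ i) (v -ᵥ (E i · v))
               → (E i · v) ≈ᵥ (E j · v)
      E·-agree v (m₁ , μ₁ , u₁ , μ₁≉ , u₁-eigen , hw₁) (m₂ , μ₂ , u₂ , μ₂≉ , u₂-eigen , hw₂) =
        u-v≈0⇒u≈v (eigen∈otherDiff⇒≈0 {X} {θ′ i} μ₁ u₁ μ₂ u₂
          (InEigenspace--ᵥ X (θ′ i) _ _ (E-·-θ′ i v) (λ k → trans (E-·-θ′ j v k) (*-cong (sym e) refl)))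
          (λ k e' → μ₁≉ k (trans e' e)) u₁-eigen μ₂≉ u₂-eigen
          (λ k → trans (sym (a-q-[a-p]≈p-q (v k) ((E i · v) k) ((E j · v) k))) (+-cong (hw₁ k) (-‿cong (hw₂ k)))))

    θ-distinct : ∀ i j → i ≢ j → ¬ (θ i ≈ θ j)
    θ-distinct i j i≢j e = θ′≈θ i (λ ei → θ′≈θ j (λ ej →
      proj₁ (proj₂ ordering) i j i≢j (θ′-injective i j (trans ei (trans e (sym ej))))))

    E-annihilates : ∀ i {μ u} → ¬ (μ ≈ θ′ i) → InEigenspace X μ u → (E i · u) ≈ᵥ 0ᵥ
    E-annihilates i {μ} {u} μ≉ u-eigen with E-complement i u
    ... | (m , μ₂ , u₂ , μ₂≉ , u₂-eigen , hw₂) =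
      eigen∈otherDiff⇒≈0 {X} {θ′ i} {E i · u} {suc zero} (λ _ → μ) (λ _ → u) μ₂ u₂ (E-·-θ′ i u) (λ _ → μ≉) (λ _ → u-eigen) μ₂≉ u₂-eigen
        (λ k → trans (sym (a-[a-p]≈p (u k) ((E i · u) k))) (+-cong (sym (+-identityʳ (u k))) (-‿cong (hw₂ k))))
      where
      a-[a-p]≈p : ∀ a p → a - (a - p) ≈ p
      a-[a-p]≈p a p = trans (+-cong refl (⁻¹-anti-homo‿- a p)) (trans (+-CS.x∙yz≈y∙xz a p (- a)) (trans (+-cong refl (-‿inverseʳ a)) (+-identityʳ p)))

    E-eigvec-offDiag : ∀ i j → j ≢ i → (E i · eigvec j) ≈ᵥ 0ᵥ
    E-eigvec-offDiag i j j≢i = E-annihilates i (λ e → θ′≈θ i (λ ei → θ-distinct j i j≢i (trans e ei))) (eigvec-eigen j)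

    E-·-lincomb : ∀ i (a : Fin n → Carrier) → (E i · vsum (λ l → a l • eigvec l)) ≈ᵥ (a i • eigvec i)
    E-·-lincomb i a = ≈ᵥ-trans (·-lincomb (E i) a eigvec) (≈ᵥ-trans (vsum-single (λ l → a l • (E i · eigvec l)) i
        (λ l ne → ≈ᵥ-trans (•-cong {a l} refl (E-eigvec-offDiag i l ne)) (•-0ᵥ (a l))))
      (•-cong {a i} refl (E-eigvec i)))

    eigvecs-basis : IsBasis eigvec
    eigvecs-basis = direct⇒isBasis eigvec eigvec≉0 λ a h k →
      ≈ᵥ-trans (≈ᵥ-sym (E-·-lincomb k a)) (≈ᵥ-trans (·-cong {E k} (λ _ _ → refl) h) (·-0ᵥ (E k)))

    open Basis eigvec eigvecs-basis public

    E-·-coord : ∀ i v → (E i · v) ≈ᵥ (coord v i • eigvec i)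
    E-·-coord i v = ≈ᵥ-trans (·-cong {E i} (λ _ _ → refl) (expansion v)) (E-·-lincomb i (coord v))

    E-X : ∀ i v → (E i · (X · v)) ≈ᵥ (θ i • (E i · v))
    E-X i v = ≈ᵥ-trans (·-cong {E i} (λ _ _ → refl) X·v≈) (≈ᵥ-trans (E-·-lincomb i (λ l → coord v l * θ l))
      (≈ᵥ-trans (λ r → trans (*-cong (*-comm _ _) refl) (*-assoc _ _ _)) (•-cong {θ i} refl (≈ᵥ-sym (E-·-coord i v)))))
      where
      X·v≈ : (X · v) ≈ᵥ vsum (λ l → (coord v l * θ l) • eigvec l)
      X·v≈ = ≈ᵥ-trans (·-cong {X} (λ _ _ → refl) (expansion v))
        (≈ᵥ-trans (·-lincomb X (coord v) eigvec) (vsum-cong (λ l → ≈ᵥ-trans (•-cong {coord v l} refl (eigvec-eigen l)) (•-assoc _ _ _))))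

    E-·-eigen : ∀ i v → InEigenspace X (θ i) (E i · v)
    E-·-eigen i v = InEigenspace-cong X (θ i) (≈ᵥ-sym (E-·-coord i v)) (InEigenspace-• {X} {θ i} (coord v i) (eigvec-eigen i))

    E-·-Represents : ∀ (M : Mat) (b : Fin n → Vec) → Represents M X b →
                     ∀ i m → (θ i • (E i · b m)) ≈ᵥ vsum (λ t → M t m • (E i · b t))
    E-·-Represents M b rep i m = ≈ᵥ-trans (≈ᵥ-sym (E-X i (b m)))
      (≈ᵥ-trans (·-cong {E i} (λ _ _ → refl) (rep m)) (·-lincomb (E i) (λ t → M t m) b))

    E·≈0⇒coord≈0 : ∀ k v → (E k · v) ≈ᵥ 0ᵥ → coord v k ≈ 0#
    E·≈0⇒coord≈0 k v e = •-basis≈0⇒≈0 k (coord v k) (≈ᵥ-trans (≈ᵥ-sym (E-·-coord k v)) e)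

    E-·≈•E-·⇒coord≈ : ∀ k {u v x} → (E k · u) ≈ᵥ (x • (E k · v)) → coord u k ≈ x * coord v k
    E-·≈•E-·⇒coord≈ k {u} {v} e = x∙y⁻¹≈ε⇒x≈y _ _ (•-basis≈0⇒≈0 k _
      (≈ᵥ-trans (λ r → trans (distribʳ _ _ _) (+-cong refl (sym (-‿distribˡ-* _ _))))
      (≈ᵥ-trans (λ r → +-cong (sym (E-·-coord k u r)) (-‿cong (trans (*-assoc _ _ _) (*-cong refl (sym (E-·-coord k v r))))))
      (u≈v⇒u-v≈0 e))))

    coord-X : ∀ v k → coord (X · v) k ≈ θ k * coord v k
    coord-X v k = E-·≈•E-·⇒coord≈ k {X · v} {v} (E-X k v)

    eigen⇒≈coord•eigvec : ∀ j v → InEigenspace X (θ j) v → v ≈ᵥ (coord v j • eigvec j)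
    eigen⇒≈coord•eigvec j v v-eigen = ≈ᵥ-trans (expansion v) (vsum-single (λ l → coord v l • eigvec l) j
        (λ l l≢j → ≈ᵥ-trans (•-cong {v = eigvec l} (coord≈0 l l≢j) ≈ᵥ-refl) (0#-• _)))
      where
      coord≈0 : ∀ l → l ≢ j → coord v l ≈ 0#
      coord≈0 l l≢j = x*y≈0⇒y≈0 (x≉y⇒x-y≉0 (θ-distinct l j l≢j)) (begin
        (θ l - θ j) * coord v l                       ≈⟨ distribʳ (coord v l) (θ l) (- θ j) ⟩
        θ l * coord v l + - θ j * coord v l           ≈⟨ +-cong (sym (coord-X v l)) (sym (-‿distribˡ-* _ _)) ⟩
        coord (X · v) l - θ j * coord v l             ≈⟨ +-cong (coord-cong v-eigen l) (-‿cong (sym (coord-• (θ j) v l))) ⟩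
        coord (θ j • v) l - coord (θ j • v) l         ≈⟨ -‿inverseʳ _ ⟩
        0# ∎)

    E-shift : ∀ k μ v → (E k · (shift X μ · v)) ≈ᵥ ((θ k - μ) • (E k · v))
    E-shift k μ v = ≈ᵥ-trans (·-cong {E k} (λ _ _ → refl) (shift-· X μ v))
      (≈ᵥ-trans (·--ᵥ (E k) (X · v) (μ • v))
      (λ r → trans (+-cong (E-X k v r) (-‿cong (·-• (E k) μ v r))) (sym (trans (distribʳ _ _ _) (+-cong refl (sym (-‿distribˡ-* _ _)))))))

    E-·-tauGen : ∀ m {k} (μ : Fin k → Carrier) (j : Fin (suc k)) v →
                 (E m · (tauGen μ X j · v)) ≈ᵥ (shiftedProd μ (θ m) j • (E m · v))
    E-·-tauGen m μ zero v = ≈ᵥ-trans (·-cong {E m} (λ _ _ → refl) (Iₘ-· v)) (≈ᵥ-sym (1#-• _))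
    E-·-tauGen m {suc k} μ (suc j) v =
      ≈ᵥ-trans (·-cong {E m} (λ _ _ → refl) (*ₘ-· (shift X (μ zero)) (tauGen (μ ∘ suc) X j) v))
      (≈ᵥ-trans (E-shift m (μ zero) (tauGen (μ ∘ suc) X j · v))
      (≈ᵥ-trans (•-cong {θ m - μ zero} refl (E-·-tauGen m (μ ∘ suc) j v)) (•-assoc _ _ _)))

    τθ : Fin n → Fin n → Carrier
    τθ i m = shiftedProd θ (θ m) (inject₁ i)

    E-·-tau : ∀ m i v → (E m · (tau θ X i · v)) ≈ᵥ (τθ i m • (E m · v))
    E-·-tau m i = E-·-tauGen m θ (inject₁ i)

    tauGen-last≈0 : ∀ v → (tauGen θ X (suc (fromℕ d)) · v) ≈ᵥ 0ᵥ
    tauGen-last≈0 v = coord≈0⇒≈0ᵥ (tauGen θ X (suc (fromℕ d)) · v) λ k → E·≈0⇒coord≈0 k (tauGen θ X (suc (fromℕ d)) · v) (≈ᵥ-trans (E-·-tauGen k θ (suc (fromℕ d)) v)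
      (≈ᵥ-trans (•-cong {v = E k · v} (shiftedProd-zero θ (θ k) (suc (fromℕ d)) k
        (P.subst (toℕ k <_) (P.cong suc (P.sym (toℕ-fromℕ d))) (toℕ<n k)) refl) ≈ᵥ-refl) (0#-• _)))

    τθ-below≈0 : ∀ i m → toℕ m < toℕ i → τθ i m ≈ 0#
    τθ-below≈0 i m lt = shiftedProd-zero θ (θ m) (inject₁ i) m (P.subst (λ t → toℕ m < t) (P.sym (toℕ-inject₁ i)) lt) refl

    τθ≉0 : ∀ i m → toℕ i ≤ toℕ m → τθ i m ≉ 0#
    τθ≉0 i m le = shiftedProd-≉0 θ (θ m) (inject₁ i) (λ l lt → θ-distinct m l
      (λ e → ℕP.<-irrefl (P.cong toℕ (P.sym e)) (ℕP.<-≤-trans (P.subst (λ t → toℕ l < t) (toℕ-inject₁ i) lt) le)))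

  -- Triangular systems

  <⇒≢ : ∀ {i j : Fin n} → toℕ i < toℕ j → i ≢ j
  <⇒≢ lt P.refl = ℕP.<-irrefl P.refl lt

  caseDec : ∀ {a b} {Q : Set a} {X : Set b} → Dec Q → (Q → X) → (¬ Q → X) → X
  caseDec (yes q) f g = f q
  caseDec (no nq) f g = g nq

  caseTri : ∀ {b} {X : Set b} (x y : ℕ) → (x < y → X) → (x ≡ y → X) → (y < x → X) → X
  caseTri x y f g h with ℕP.<-cmp x y
  ... | tri< p _ _ = f p
  ... | tri≈ _ p _ = g p
  ... | tri> _ _ p = h p

  inject₁<suc : ∀ (i : Fin d) → toℕ (inject₁ i) < toℕ (suc i)
  inject₁<suc i = s≤s (ℕP.≤-reflexive (toℕ-inject₁ i))

  inject₁≢suc : ∀ (i : Fin d) → inject₁ i ≢ suc i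
  inject₁≢suc i e = ℕP.<-irrefl (P.cong toℕ e) (inject₁<suc i)

  fromℕ⊎inject₁ : ∀ {m} (j : Fin (suc m)) → (j ≡ fromℕ m) ⊎ Σ (Fin m) (λ j' → j ≡ inject₁ j')
  fromℕ⊎inject₁ {zero} zero = inj₁ P.refl
  fromℕ⊎inject₁ {suc m} zero = inj₂ (zero , P.refl)
  fromℕ⊎inject₁ {suc m} (suc j) with fromℕ⊎inject₁ j
  ... | inj₁ e = inj₁ (P.cong suc e)
  ... | inj₂ (k , e) = inj₂ (suc k , P.cong suc e)

  <-rec : ∀ {a} (P : Fin n → Set a) → (∀ m → (∀ t → t Fin.< m → P t) → P m) → ∀ m → P m
  <-rec {a} P step = WF.All.wfRec FinInd.<-wellFounded a P (λ m rec → step m (λ t → rec))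

  module Triangular (_≺_ : Rel (Fin n) 0ℓ) (≺-wellFounded : WellFounded _≺_) (_≺?_ : Decidable _≺_) where
    solution≈0 : (Good : Fin n → Set) → (∀ m t → Good m → t ≺ m → Good t) →
                 (a : Fin n → Carrier) (λ₀ : Carrier) (N : Fin n → Fin n → Carrier) →
                 (∀ m → Good m → λ₀ * a m ≈ sumF (λ t → N m t * a t)) →
                 (∀ m t → t ≢ m → ¬ (t ≺ m) → N m t ≈ 0#) →
                 (∀ m → Good m → N m m - λ₀ ≉ 0#) →
                 ∀ m → Good m → a m ≈ 0#
    solution≈0 Good Good-closed a λ₀ N system triangular diagonal =
      WF.All.wfRec ≺-wellFounded ℓ (λ m → Good m → a m ≈ 0#) step
      where
      step : ∀ m → (∀ {t} → t ≺ m → Good t → a t ≈ 0#) → Good m → a m ≈ 0#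
      step m IH good = x*y≈0⇒y≈0 (diagonal m good) (trans (distribʳ (a m) (N m m) (- λ₀))
          (trans (+-cong (sym diagonal-term) (trans (sym (-‿distribˡ-* _ _)) (-‿cong (system m good)))) (-‿inverseʳ _)))
        where
        offDiagonal : ∀ t → t ≢ m → N m t * a t ≈ 0#
        offDiagonal t t≢m with t ≺? m
        ... | yes t≺m = trans (*-cong refl (IH t≺m (Good-closed m t good t≺m))) (zeroʳ _)
        ... | no t⊀m = trans (*-cong (triangular m t t≢m t⊀m) refl) (zeroˡ _)
        diagonal-term : sumF (λ t → N m t * a t) ≈ N m m * a m
        diagonal-term = sumF-single {n} (λ t → N m t * a t) m offDiagonal

    solution≈0ᵥ : (Good : Fin n → Set) → (∀ m t → Good m → t ≺ m → Good t) →
                  (z : Fin n → Vec) (λ₀ : Carrier) (N : Fin n → Fin n → Carrier) →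
                  (∀ m → (λ₀ • z m) ≈ᵥ vsum (λ t → N m t • z t)) →
                  (∀ m t → t ≢ m → ¬ (t ≺ m) → N m t ≈ 0#) →
                  (∀ m → Good m → N m m - λ₀ ≉ 0#) →
                  ∀ m → Good m → z m ≈ᵥ 0ᵥ
    solution≈0ᵥ Good Good-closed z λ₀ N system triangular diagonal m good r =
      solution≈0 Good Good-closed (λ t → z t r) λ₀ N (λ t _ → system t r) triangular diagonal m good

    combination≈0 : (Good : Fin n → Set) → (∀ m t → Good m → t ≺ m → Good t) →
                    (c : Fin n → Fin n → Carrier) → (∀ m t → t ≢ m → ¬ (t ≺ m) → c t m ≈ 0#) → (∀ m → c m m ≉ 0#) →
                    (a w : Fin n → Carrier) → (∀ m → w m ≈ sumF (λ t → a t * c t m)) → (∀ m → Good m → w m ≈ 0#) →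
                    ∀ m → Good m → a m ≈ 0#
    combination≈0 Good Good-closed c triangular diagonal a w w≈ w≈0 =
      solution≈0 Good Good-closed a 0# (λ m t → c t m)
        (λ m good → trans (zeroˡ _) (sym (trans (sumF-cong {n} {λ t → c t m * a t} {λ t → a t * c t m} (λ t → *-comm _ _)) (trans (sym (w≈ m)) (w≈0 m good)))))
        triangular (λ m _ → ≉0-resp-≈ (sym (trans (+-cong refl -0#≈0#) (+-identityʳ _))) (diagonal m))

  module Upward = Triangular Fin._<_ FinInd.<-wellFounded FinP._<?_

  module Downward = Triangular Fin._>_ FinInd.>-wellFounded (λ t m → m FinP.<? t)

  lowerBidiag-diag : ∀ θ i → lowerBidiag θ i i ≈ θ i
  lowerBidiag-diag θ i with i Fin.≟ i | toℕ i ℕ.≟ suc (toℕ i)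
  ... | yes _ | _ = refl
  ... | no ne | _ = ⊥-elim (ne P.refl)

  lowerBidiag-sub : ∀ θ i j → toℕ i ≡ suc (toℕ j) → lowerBidiag θ i j ≈ 1#
  lowerBidiag-sub θ i j e with i Fin.≟ j | toℕ i ℕ.≟ suc (toℕ j)
  ... | yes P.refl | _ = ⊥-elim (ℕP.<-irrefl e ℕP.≤-refl)
  ... | no _ | yes _ = refl
  ... | no _ | no ne = ⊥-elim (ne e)

  lowerBidiag-zero : ∀ θ i j → i ≢ j → toℕ i ≢ suc (toℕ j) → lowerBidiag θ i j ≈ 0#
  lowerBidiag-zero θ i j n1 n2 with i Fin.≟ j | toℕ i ℕ.≟ suc (toℕ j)
  ... | yes e | _ = ⊥-elim (n1 e)
  ... | no _ | yes e = ⊥-elim (n2 e)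
  ... | no _ | no _ = refl

  upperBidiag-diag : ∀ θs φ i → upperBidiag θs φ i i ≈ θs i
  upperBidiag-diag θs φ zero = refl
  upperBidiag-diag θs φ (suc k) with suc k Fin.≟ suc k | toℕ (suc k) ℕ.≟ toℕ k
  ... | yes _ | _ = refl
  ... | no ne | _ = ⊥-elim (ne P.refl)

  upperBidiag-zero : ∀ θs φ i j → i ≢ j → toℕ j ≢ suc (toℕ i) → upperBidiag θs φ i j ≈ 0#
  upperBidiag-zero θs φ i zero n1 n2 with i Fin.≟ zero
  ... | yes e = ⊥-elim (n1 e)
  ... | no _ = refl
  upperBidiag-zero θs φ i (suc k) n1 n2 with i Fin.≟ suc k | toℕ i ℕ.≟ toℕ k
  ... | yes e | _ = ⊥-elim (n1 e)
  ... | no _ | yes e = ⊥-elim (n2 (P.cong suc (P.sym e)))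
  ... | no _ | no _ = refl

  upperBidiag-super : ∀ θs φ i k → toℕ i ≡ toℕ k → upperBidiag θs φ i (suc k) ≈ φ k
  upperBidiag-super θs φ i k e with i Fin.≟ suc k | toℕ i ℕ.≟ toℕ k
  ... | yes P.refl | _ = ⊥-elim (ℕP.<-irrefl (P.sym e) ℕP.≤-refl)
  ... | no _ | yes _ = refl
  ... | no _ | no ne = ⊥-elim (ne e)

  module _ (θ : Fin n → Carrier) (b : Fin n → Vec) where
    lowerBidiag-column : ∀ (j : Fin d) →
      vsum (λ i → lowerBidiag θ i (inject₁ j) • b i) ≈ᵥ ((θ (inject₁ j) • b (inject₁ j)) +ᵥ b (suc j))
    lowerBidiag-column j = ≈ᵥ-trans (vsum-pair _ (inject₁ j) (suc j) (inject₁≢suc j) offColumn)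
        (λ r → +-cong (*-cong (lowerBidiag-diag θ (inject₁ j)) refl)
                      (trans (*-cong (lowerBidiag-sub θ (suc j) (inject₁ j) (P.cong suc (P.sym (toℕ-inject₁ j)))) refl) (*-identityˡ _)))
      where
      offColumn : ∀ k → k ≢ inject₁ j → k ≢ suc j → (lowerBidiag θ k (inject₁ j) • b k) ≈ᵥ 0ᵥ
      offColumn k k≢j k≢sj = ≈ᵥ-trans (•-cong {v = b k} (lowerBidiag-zero θ k (inject₁ j) k≢j
        (λ e → k≢sj (toℕ-injective (P.trans e (P.cong suc (toℕ-inject₁ j)))))) ≈ᵥ-refl) (0#-• _)

    lowerBidiag-lastColumn : vsum (λ i → lowerBidiag θ i (fromℕ d) • b i) ≈ᵥ (θ (fromℕ d) • b (fromℕ d))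
    lowerBidiag-lastColumn = ≈ᵥ-trans (vsum-single _ (fromℕ d) offColumn)
      (•-cong {v = b (fromℕ d)} (lowerBidiag-diag θ (fromℕ d)) ≈ᵥ-refl)
      where
      offColumn : ∀ k → k ≢ fromℕ d → (lowerBidiag θ k (fromℕ d) • b k) ≈ᵥ 0ᵥ
      offColumn k k≢d = ≈ᵥ-trans (•-cong {v = b k} (lowerBidiag-zero θ k (fromℕ d) k≢d
        (λ e → ℕP.<-irrefl (P.trans e (P.cong suc (toℕ-fromℕ d))) (toℕ<n k))) ≈ᵥ-refl) (0#-• _)

  module _ (θs : Fin n → Carrier) (φ : Fin d → Carrier) (b : Fin n → Vec) where
    upperBidiag-firstColumn : vsum (λ i → upperBidiag θs φ i zero • b i) ≈ᵥ (θs zero • b zero)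
    upperBidiag-firstColumn = ≈ᵥ-trans (vsum-single _ zero offColumn)
      (•-cong {v = b zero} (upperBidiag-diag θs φ zero) ≈ᵥ-refl)
      where
      offColumn : ∀ i → i ≢ zero → (upperBidiag θs φ i zero • b i) ≈ᵥ 0ᵥ
      offColumn i i≢0 = ≈ᵥ-trans (•-cong {v = b i} (upperBidiag-zero θs φ i zero i≢0 (λ ())) ≈ᵥ-refl) (0#-• _)

    upperBidiag-column : ∀ (i : Fin d) →
      vsum (λ k → upperBidiag θs φ k (suc i) • b k) ≈ᵥ ((θs (suc i) • b (suc i)) +ᵥ (φ i • b (inject₁ i)))
    upperBidiag-column i = ≈ᵥ-trans (vsum-pair _ (suc i) (inject₁ i) (λ e → inject₁≢suc i (P.sym e)) offColumn)
      (λ r → +-cong (*-cong (upperBidiag-diag θs φ (suc i)) refl) (*-cong (upperBidiag-super θs φ (inject₁ i) i (toℕ-inject₁ i)) refl))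
      where
      offColumn : ∀ k → k ≢ suc i → k ≢ inject₁ i → (upperBidiag θs φ k (suc i) • b k) ≈ᵥ 0ᵥ
      offColumn k k≢si k≢i = ≈ᵥ-trans (•-cong {v = b k} (upperBidiag-zero θs φ k (suc i) k≢si
        (λ e → k≢i (toℕ-injective (P.trans (ℕP.suc-injective (P.sym e)) (P.sym (toℕ-inject₁ i)))))) ≈ᵥ-refl) (0#-• _)

  module _ {X : Mat} {θ : Fin n → Carrier} {b : Fin n → Vec} where
    Represents-lowerBidiag⇒ : Represents (lowerBidiag θ) X b →
                              ∀ (j : Fin d) → (shift X (θ (inject₁ j)) · b (inject₁ j)) ≈ᵥ b (suc j)
    Represents-lowerBidiag⇒ rep j = shift-·-unsolve X _ _ _ (≈ᵥ-trans (rep (inject₁ j)) (lowerBidiag-column θ b j))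

    Represents-lowerBidiag⇐ : (∀ (j : Fin d) → (shift X (θ (inject₁ j)) · b (inject₁ j)) ≈ᵥ b (suc j)) →
                              (shift X (θ (fromℕ d)) · b (fromℕ d)) ≈ᵥ 0ᵥ → Represents (lowerBidiag θ) X b
    Represents-lowerBidiag⇐ columns last j with fromℕ⊎inject₁ j
    ... | inj₁ P.refl = ≈ᵥ-trans (shift-·-solve X _ _ _ last)
                          (≈ᵥ-trans (λ r → +-identityʳ _) (≈ᵥ-sym (lowerBidiag-lastColumn θ b)))
    ... | inj₂ (j' , P.refl) = ≈ᵥ-trans (shift-·-solve X _ _ _ (columns j')) (≈ᵥ-sym (lowerBidiag-column θ b j'))

    Represents-lowerBidiag⇒tau : Represents (lowerBidiag θ) X b → ∀ i → b i ≈ᵥ (tau θ X i · b zero)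
    Represents-lowerBidiag⇒tau rep = <-rec (λ i → b i ≈ᵥ (tau θ X i · b zero)) step
      where
      step : ∀ m → (∀ t → t Fin.< m → b t ≈ᵥ (tau θ X t · b zero)) → b m ≈ᵥ (tau θ X m · b zero)
      step zero IH = ≈ᵥ-sym (tau-zero θ X (b zero))
      step (suc i) IH = ≈ᵥ-trans (≈ᵥ-sym (Represents-lowerBidiag⇒ rep i))
        (≈ᵥ-trans (·-cong {shift X (θ (inject₁ i))} (λ _ _ → refl) (IH (inject₁ i) (inject₁<suc i))) (≈ᵥ-sym (tau-suc θ X i (b zero))))

  module _ {X : Mat} {θs : Fin n → Carrier} {φ : Fin d → Carrier} {b : Fin n → Vec} where
    Represents-upperBidiag⇒₀ : Represents (upperBidiag θs φ) X b → InEigenspace X (θs zero) (b zero)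
    Represents-upperBidiag⇒₀ rep = ≈ᵥ-trans (rep zero) (upperBidiag-firstColumn θs φ b)

    Represents-upperBidiag⇒ : Represents (upperBidiag θs φ) X b →
                              ∀ (i : Fin d) → (shift X (θs (suc i)) · b (suc i)) ≈ᵥ (φ i • b (inject₁ i))
    Represents-upperBidiag⇒ rep i = shift-·-unsolve X _ _ _ (≈ᵥ-trans (rep (suc i)) (upperBidiag-column θs φ b i))

    Represents-upperBidiag⇐ : (shift X (θs zero) · b zero) ≈ᵥ 0ᵥ →
                              (∀ (i : Fin d) → (shift X (θs (suc i)) · b (suc i)) ≈ᵥ (φ i • b (inject₁ i))) →
                              Represents (upperBidiag θs φ) X b
    Represents-upperBidiag⇐ first columns zero = ≈ᵥ-trans (shift-·-solve X _ _ _ first)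
      (≈ᵥ-trans (λ r → +-identityʳ _) (≈ᵥ-sym (upperBidiag-firstColumn θs φ b)))
    Represents-upperBidiag⇐ first columns (suc i) =
      ≈ᵥ-trans (shift-·-solve X _ _ _ (columns i)) (≈ᵥ-sym (upperBidiag-column θs φ b i))

  lowerBidiag-·-above≈0 : ∀ θ (a : Fin n → Carrier) J → (∀ k → J < toℕ k → a k ≈ 0#) →
                          ∀ m → suc J < toℕ m → (lowerBidiag θ · a) m ≈ 0#
  lowerBidiag-·-above≈0 θ a J a-above≈0 m J+1<m = sumF-zero {n} (λ k → lowerBidiag θ m k * a k) term
    where
    term : ∀ k → lowerBidiag θ m k * a k ≈ 0#
    term k with J <? toℕ k
    ... | yes J<k = trans (*-cong refl (a-above≈0 k J<k)) (zeroʳ _)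
    ... | no J≮k = trans (*-cong (lowerBidiag-zero θ m k
            (λ e → ℕP.<-irrefl (P.cong toℕ (P.sym e)) (ℕP.<-≤-trans (s≤s (ℕP.≮⇒≥ J≮k)) (ℕP.<⇒≤ J+1<m)))
            (λ e → ℕP.<-irrefl (P.sym e) (ℕP.<-≤-trans (s≤s (s≤s (ℕP.≮⇒≥ J≮k))) J+1<m))) refl) (zeroˡ _)

  upperBidiag-·-below≈0 : ∀ θs φ (a : Fin n → Carrier) J → (∀ k → toℕ k < J → a k ≈ 0#) →
                          ∀ m → suc (toℕ m) < J → (upperBidiag θs φ · a) m ≈ 0#
  upperBidiag-·-below≈0 θs φ a J a-below≈0 m m+1<J = sumF-zero {n} (λ k → upperBidiag θs φ m k * a k) term
    where
    term : ∀ k → upperBidiag θs φ m k * a k ≈ 0#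
    term k with toℕ k <? J
    ... | yes k<J = trans (*-cong refl (a-below≈0 k k<J)) (zeroʳ _)
    ... | no k≮J = trans (*-cong (upperBidiag-zero θs φ m k
            (λ e → ℕP.<-irrefl (P.cong toℕ e) (ℕP.<-≤-trans (ℕP.<-trans ℕP.≤-refl m+1<J) (ℕP.≮⇒≥ k≮J)))
            (λ e → ℕP.<-irrefl (P.sym e) (ℕP.<-≤-trans m+1<J (ℕP.≮⇒≥ k≮J)))) refl) (zeroˡ _)

  Represents-· : ∀ (M X : Mat) (b : Fin n → Vec) → Represents M X b → ∀ a →
            (X · vsum (λ k → a k • b k)) ≈ᵥ vsum (λ i → (M · a) i • b i)
  Represents-· M X b rep a r = begin
    (X · vsum (λ k → a k • b k)) r
      ≈⟨ ·-lincomb X a b r ⟩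
    sumF (λ k → a k * (X · b k) r)
      ≈⟨ sumF-cong {n} {λ k → a k * (X · b k) r} {λ k → sumF (λ i → a k * (M i k * b i r))}
           (λ k → trans (*-cong refl (rep k r)) (*-distribˡ-sumF (a k) (λ i → M i k * b i r))) ⟩
    sumF (λ k → sumF (λ i → a k * (M i k * b i r)))
      ≈⟨ sumF-comm {n} {n} (λ k i → a k * (M i k * b i r)) ⟩
    sumF (λ i → sumF (λ k → a k * (M i k * b i r)))
      ≈⟨ sumF-cong {n} {λ i → sumF (λ k → a k * (M i k * b i r))} {λ i → (M · a) i * b i r}
           (λ i → trans (sumF-cong {n} {λ k → a k * (M i k * b i r)} {λ k → (M i k * a k) * b i r}
                          (λ k → trans (sym (*-assoc _ _ _)) (*-cong (*-comm _ _) refl)))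
                        (sym (*-distribʳ-sumF (b i r) (λ k → M i k * a k)))) ⟩
    sumF (λ i → (M · a) i * b i r) ∎

  eigenvector-coords : ∀ (M X : Mat) (b : Fin n → Vec) → IsBasis b → Represents M X b → ∀ {μ y} (a : Fin n → Carrier) →
     y ≈ᵥ vsum (λ k → a k • b k) → InEigenspace X μ y → ∀ i → (M · a) i ≈ (μ * a i)
  eigenvector-coords M X b B rep {μ} {y} a hy ey = Basis.lincomb-injective b B (λ i → (M · a) i) (λ i → μ * a i)
     (≈ᵥ-trans (≈ᵥ-sym (Represents-· M X b rep a)) (≈ᵥ-trans (·-cong {X} {X} {vsum (λ k → a k • b k)} {y} (λ _ _ → refl) (≈ᵥ-sym hy))
        (≈ᵥ-trans ey (≈ᵥ-trans (•-cong {μ} refl hy) (•-lincomb μ a b)))))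

  ∈span1⇒ : ∀ {S g w} → S ≐ span1 g → S w → Σ Carrier (λ a → w ≈ᵥ (a • g))
  ∈span1⇒ (h1 , h2) sw = h1 _ sw

  span1⇒∈ : ∀ {S g w} a → S ≐ span1 g → w ≈ᵥ (a • g) → S w
  span1⇒∈ a (h1 , h2) e = h2 _ (a , e)

  span1-resp : ∀ {S g w w'} → S ≐ span1 g → S w → w' ≈ᵥ w → S w'
  span1-resp h sw e = span1⇒∈ (proj₁ (∈span1⇒ h sw)) h (≈ᵥ-trans e (proj₂ (∈span1⇒ h sw)))

  span1-• : ∀ {S g w} c → S ≐ span1 g → S w → S (c • w)
  span1-• {g = g} c h sw = span1⇒∈ (c * proj₁ (∈span1⇒ h sw)) h (≈ᵥ-trans (•-cong {c} refl (proj₂ (∈span1⇒ h sw))) (•-assoc c (proj₁ (∈span1⇒ h sw)) g))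

  span1-0ᵥ : ∀ {S g} → S ≐ span1 g → S 0ᵥ
  span1-0ᵥ {g = g} h = span1⇒∈ 0# h (≈ᵥ-sym (0#-• g))

  span1-generator : ∀ {S g w} → S ≐ span1 g → S w → ¬ (w ≈ᵥ 0ᵥ) → ∀ v → S v → Σ Carrier (λ c → v ≈ᵥ (c • w))
  span1-generator {S} {g} {w} h sw nw v sv = (a' * inv nza) , ≈ᵥ-trans ev (λ i → sym (trans (*-cong refl (ew i)) (inv-cancel a' (inv nza) a (g i) (inv-inverseˡ nza))))
    where
    a : Carrier
    a = proj₁ (∈span1⇒ h sw)
    ew : w ≈ᵥ (a • g)
    ew = proj₂ (∈span1⇒ h sw)
    a' : Carrier
    a' = proj₁ (∈span1⇒ h sv)
    ev : v ≈ᵥ (a' • g)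
    ev = proj₂ (∈span1⇒ h sv)
    nza : (a ≉ 0#)
    nza e = nw (≈ᵥ-trans ew (≈ᵥ-trans (•-cong {v = g} e ≈ᵥ-refl) (0#-• g)))

  ≐-trans : ∀ {S T W : Subspace} → S ≐ T → T ≐ W → S ≐ W
  ≐-trans (a , b') (c' , d') = (λ w h → c' w (a w h)) , (λ w h → b' w (d' w h))

  ≐-sym : ∀ {S T : Subspace} → S ≐ T → T ≐ S
  ≐-sym (a , b') = b' , a

  span1-•-≉0 : ∀ {v v'} s → (s ≉ 0#) → v' ≈ᵥ (s • v) → span1 v' ≐ span1 v
  span1-•-≉0 {v} {v'} s nz e = (λ w (a , ew) → (a * s) , ≈ᵥ-trans ew (≈ᵥ-trans (•-cong {a} refl e) (•-assoc a s v)))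
                              , (λ w (a , ew) → (a * inv nz) , ≈ᵥ-trans ew (λ r → sym (trans (*-cong refl (e r)) (inv-cancel a (inv nz) s (v r) (inv-inverseˡ nz)))))

  Image-span1 : ∀ {X u v} → (X · u) ≈ᵥ v → Image X (span1 u) ≐ span1 v
  Image-span1 {X} {u} X·u≈v = (λ w (u′ , (x , u′≈) , w≈) → x , ≈ᵥ-trans w≈ (≈ᵥ-trans (·-cong {X} (λ _ _ → refl) u′≈)
                                                        (≈ᵥ-trans (·-• X x u) (•-cong {x} refl X·u≈v))))
                            , (λ w (x , w≈) → x • u , (x , ≈ᵥ-refl) , ≈ᵥ-trans w≈ (≈ᵥ-trans (•-cong {x} refl (≈ᵥ-sym X·u≈v)) (≈ᵥ-sym (·-• X x u))))

  Image-span1-⊆ : ∀ {X u v y} → (X · u) ≈ᵥ (y • v) → Image X (span1 u) ⊆ span1 v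
  Image-span1-⊆ {X} {u} {v} {y} X·u≈ w (u′ , (x , u′≈) , w≈) = x * y , ≈ᵥ-trans w≈ (≈ᵥ-trans (·-cong {X} (λ _ _ → refl) u′≈)
    (≈ᵥ-trans (·-• X x u) (≈ᵥ-trans (•-cong {x} refl X·u≈) (•-assoc x y v))))

  Image-span1-zero : ∀ {X u} → (X · u) ≈ᵥ 0ᵥ → Image X (span1 u) ≐ ZeroSub
  Image-span1-zero {X} {u} X·u≈0 = (λ w (u′ , (x , u′≈) , w≈) → lift (≈ᵥ-trans w≈ (≈ᵥ-trans (·-cong {X} (λ _ _ → refl) u′≈)
                                                                 (≈ᵥ-trans (·-• X x u) (≈ᵥ-trans (•-cong {x} refl X·u≈0) (•-0ᵥ x))))))
                                 , (λ w (lift w≈0) → 0ᵥ , (0# , ≈ᵥ-sym (0#-• u)) , ≈ᵥ-trans w≈0 (≈ᵥ-sym (·-0ᵥ X)))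

  Image≐0⇒·≈0ᵥ : ∀ {X S} → Image X S ≐ ZeroSub → ∀ v → S v → (X · v) ≈ᵥ 0ᵥ
  Image≐0⇒·≈0ᵥ h v sv = lower (proj₁ h _ (v , sv , ≈ᵥ-refl))

  -- (ii) ⇒ (iii)

  module FromDecomposition (A As : Mat) (θ θs : Fin n → Carrier) (U : Fin n → Subspace)
                           (decomposition : IsDecomposition U) (condII : CondIIFor A As θ θs U) where
    private
      A-step : ∀ (i : Fin d) → Image (shift A (θ (inject₁ i))) (U (inject₁ i)) ≐ U (suc i)
      A-step = proj₁ condII
      A-last : Image (shift A (θ (fromℕ d))) (U (fromℕ d)) ≐ ZeroSub
      A-last = proj₁ (proj₂ condII)
      A*-step : ∀ (i : Fin d) → Image (shift As (θs (suc i))) (U (suc i)) ⊆ U (inject₁ i)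
      A*-step = proj₁ (proj₂ (proj₂ condII))
      A*-first : Image (shift As (θs zero)) (U zero) ≐ ZeroSub
      A*-first = proj₂ (proj₂ (proj₂ condII))

      g : Fin n → Vec
      g i = proj₁ (proj₁ decomposition i)
      U≐span-g : ∀ i → U i ≐ span1 (g i)
      U≐span-g i = proj₂ (proj₂ (proj₁ decomposition i))

    g₀ : Vec
    g₀ = g zero

    g≉0 : ∀ i → ¬ (g i ≈ᵥ 0ᵥ)
    g≉0 i = proj₁ (proj₂ (proj₁ decomposition i))

    g₀-eigen : InEigenspace As (θs zero) g₀
    g₀-eigen = ≈ᵥ-trans (shift-·-solve As (θs zero) g₀ 0ᵥ
      (Image≐0⇒·≈0ᵥ {shift As (θs zero)} {U zero} A*-first g₀ (span1⇒∈ 1# (U≐span-g zero) (≈ᵥ-sym (1#-• g₀))))) (λ r → +-identityʳ _)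

    b : Fin n → Vec
    b i = tau θ A i · g₀

    private
      Spans : Fin n → Set (c ⊔ ℓ)
      Spans i = U i (b i) × ¬ (b i ≈ᵥ 0ᵥ)

      -- g (i+1) lies in U (i+1) = (A - θᵢ) U i = (A - θᵢ) span (b i), so it is a multiple of b (i+1).
      spans-step : ∀ m → (∀ t → t Fin.< m → Spans t) → Spans m
      spans-step zero _ = span1-resp (U≐span-g zero) (span1⇒∈ 1# (U≐span-g zero) (≈ᵥ-sym (1#-• g₀))) (tau-zero θ A g₀)
                        , (λ e → g≉0 zero (≈ᵥ-trans (≈ᵥ-sym (tau-zero θ A g₀)) e))
      spans-step (suc i) IH = b∈U , b≉0
        where
        X : Mat
        X = shift A (θ (inject₁ i))
        previous : Spans (inject₁ i)
        previous = IH (inject₁ i) (inject₁<suc i)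
        b∈U : U (suc i) (b (suc i))
        b∈U = proj₁ (A-step i) (b (suc i)) (b (inject₁ i) , proj₁ previous , tau-suc θ A i g₀)
        g-preimage : Image X (U (inject₁ i)) (g (suc i))
        g-preimage = proj₂ (A-step i) (g (suc i)) (span1⇒∈ 1# (U≐span-g (suc i)) (≈ᵥ-sym (1#-• (g (suc i)))))
        v : Vec
        v = proj₁ g-preimage
        v-multiple : Σ Carrier (λ x → v ≈ᵥ (x • b (inject₁ i)))
        v-multiple = span1-generator (U≐span-g (inject₁ i)) (proj₁ previous) (proj₂ previous) v (proj₁ (proj₂ g-preimage))
        b≉0 : ¬ (b (suc i) ≈ᵥ 0ᵥ)
        b≉0 e = g≉0 (suc i) (≈ᵥ-trans (proj₂ (proj₂ g-preimage))
          (≈ᵥ-trans (·-cong {X} (λ _ _ → refl) (proj₂ v-multiple)) (≈ᵥ-trans (·-• X (proj₁ v-multiple) (b (inject₁ i)))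
          (≈ᵥ-trans (•-cong {proj₁ v-multiple} refl (≈ᵥ-trans (≈ᵥ-sym (tau-suc θ A i g₀)) e)) (•-0ᵥ _)))))

    b∈U : ∀ i → U i (b i)
    b∈U i = proj₁ (<-rec Spans spans-step i)

    b≉0 : ∀ i → ¬ (b i ≈ᵥ 0ᵥ)
    b≉0 i = proj₂ (<-rec Spans spans-step i)

    U≐span-b : ∀ i → U i ≐ span1 (b i)
    U≐span-b i = (λ w w∈U → span1-generator (U≐span-g i) (b∈U i) (b≉0 i) w w∈U)
               , (λ w (x , w≈) → span1-resp (U≐span-g i) (span1-• x (U≐span-g i) (b∈U i)) w≈)

    b-basis : IsBasis b
    b-basis = direct⇒isBasis b b≉0 λ a h → proj₂ (proj₂ decomposition) (λ i → a i • b i) (λ _ → 0ᵥ)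
      (λ i → span1-• (a i) (U≐span-g i) (b∈U i)) (λ i → span1-0ᵥ (U≐span-g i))
      (≈ᵥ-trans h (λ r → sym (sumF-zero {n} (λ _ → 0#) (λ _ → refl))))

    private
      A*-lowers : ∀ (i : Fin d) → Σ Carrier (λ x → (shift As (θs (suc i)) · b (suc i)) ≈ᵥ (x • b (inject₁ i)))
      A*-lowers i = span1-generator (U≐span-g (inject₁ i)) (b∈U (inject₁ i)) (b≉0 (inject₁ i)) _
                      (A*-step i _ (b (suc i) , b∈U (suc i) , ≈ᵥ-refl))

    φ : Fin d → Carrier
    φ i = proj₁ (A*-lowers i)

    condIII : CondIII A As θ θs
    condIII = φ , b , b-basis
      , Represents-lowerBidiag⇐ {A} {θ} {b} (λ j → ≈ᵥ-sym (tau-suc θ A j g₀)) (Image≐0⇒·≈0ᵥ {shift A (θ (fromℕ d))} {U (fromℕ d)} A-last (b (fromℕ d)) (b∈U (fromℕ d)))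
      , Represents-upperBidiag⇐ {As} {θs} {φ} {b} (Image≐0⇒·≈0ᵥ {shift As (θs zero)} {U zero} A*-first (b zero) (b∈U zero)) (λ i → proj₂ (A*-lowers i))

  ii⇒iii : ∀ A As θ θs → CondII A As θ θs → CondIII A As θ θs
  ii⇒iii A As θ θs (U , decomposition , condII) = FromDecomposition.condIII A As θ θs U decomposition condII

  module PreLeonard (A : Mat) (E : Fin n → Mat) (As : Mat) (Es : Fin n → Mat) (θ θs : Fin n → Carrier)
                    (PL : IsPreLeonardSystem A E As Es θ θs) where
    E-ordering : IsOrdering A E
    E-ordering = proj₁ (proj₂ (proj₂ PL))
    E*-ordering : IsOrdering As Es
    E*-ordering = proj₁ (proj₂ (proj₂ (proj₂ PL)))
    AE≈θE : ∀ i → (A *ₘ E i) ≈ₘ (θ i •ₘ E i)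
    AE≈θE = proj₁ (proj₂ (proj₂ (proj₂ (proj₂ PL))))
    A*E*≈θ*E* : ∀ i → (As *ₘ Es i) ≈ₘ (θs i •ₘ Es i)
    A*E*≈θ*E* = proj₂ (proj₂ (proj₂ (proj₂ (proj₂ PL))))

    module PI = PrimitiveIdempotents A E θ E-ordering AE≈θE
    module PI* = PrimitiveIdempotents As Es θs E*-ordering A*E*≈θ*E*

    module FromBidiagonalBasis (φ : Fin d → Carrier) (b : Fin n → Vec) (condIII : CondIIIFor A As θ θs φ b) where
      private
        Lθ Uφ : Mat
        Lθ = lowerBidiag θ
        Uφ = upperBidiag θs φ
        A-rep : Represents Lθ A b
        A-rep = proj₁ (proj₂ condIII)
        A*-rep : Represents Uφ As b
        A*-rep = proj₂ (proj₂ condIII)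

      open Basis b (proj₁ condIII) using (coord; expansion)

      E*-basis-below≈0 : ∀ i m → m Fin.< i → (Es i · b m) ≈ᵥ 0ᵥ
      E*-basis-below≈0 i = Upward.solution≈0ᵥ (λ m → m Fin.< i) (λ m t m<i t<m → ℕP.<-trans t<m m<i)
        (λ m → Es i · b m) (θs i) (λ m t → Uφ t m) (PI*.E-·-Represents Uφ b A*-rep i)
        (λ m t t≢m t≮m → upperBidiag-zero θs φ t m t≢m (λ e → t≮m (ℕP.≤-reflexive (P.sym e))))
        (λ m m<i → ≉0-resp-≈ (+-cong (sym (upperBidiag-diag θs φ m)) refl) (x≉y⇒x-y≉0 (PI*.θ-distinct m i (<⇒≢ m<i))))

      E-basis-above≈0 : ∀ i m → i Fin.< m → (E i · b m) ≈ᵥ 0ᵥ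
      E-basis-above≈0 i = Downward.solution≈0ᵥ (λ m → i Fin.< m) (λ m t i<m m<t → ℕP.<-trans i<m m<t)
        (λ m → E i · b m) (θ i) (λ m t → Lθ t m) (PI.E-·-Represents Lθ b A-rep i)
        (λ m t t≢m m≮t → lowerBidiag-zero θ t m t≢m (λ e → m≮t (ℕP.≤-reflexive (P.sym e))))
        (λ m i<m → ≉0-resp-≈ (+-cong (sym (lowerBidiag-diag θ m)) refl) (x≉y⇒x-y≉0 (PI.θ-distinct m i (λ e → <⇒≢ i<m (P.sym e)))))

      A*-eigen-coords-above≈0 : ∀ j y → InEigenspace As (θs j) y → ∀ k → j Fin.< k → coord y k ≈ 0#
      A*-eigen-coords-above≈0 j y y-eigen = Downward.solution≈0 (λ m → j Fin.< m) (λ m t j<m m<t → ℕP.<-trans j<m m<t)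
        (coord y) (θs j) Uφ (λ m _ → sym (eigenvector-coords Uφ As b (proj₁ condIII) A*-rep (coord y) (expansion y) y-eigen m))
        (λ m t t≢m m≮t → upperBidiag-zero θs φ m t (λ e → t≢m (P.sym e)) (λ e → m≮t (ℕP.≤-reflexive (P.sym e))))
        (λ m j<m → ≉0-resp-≈ (+-cong (sym (upperBidiag-diag θs φ m)) refl) (x≉y⇒x-y≉0 (PI*.θ-distinct m j (λ e → <⇒≢ j<m (P.sym e)))))

      A-eigen-coords-below≈0 : ∀ j y → InEigenspace A (θ j) y → ∀ k → k Fin.< j → coord y k ≈ 0#
      A-eigen-coords-below≈0 j y y-eigen = Upward.solution≈0 (λ m → m Fin.< j) (λ m t m<j t<m → ℕP.<-trans t<m m<j)
        (coord y) (θ j) Lθ (λ m _ → sym (eigenvector-coords Lθ A b (proj₁ condIII) A-rep (coord y) (expansion y) y-eigen m))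
        (λ m t t≢m t≮m → lowerBidiag-zero θ m t (λ e → t≢m (P.sym e)) (λ e → t≮m (ℕP.≤-reflexive (P.sym e))))
        (λ m m<j → ≉0-resp-≈ (+-cong (sym (lowerBidiag-diag θ m)) refl) (x≉y⇒x-y≉0 (PI.θ-distinct m j (<⇒≢ m<j))))

      -- E*ⱼV ⊆ span(b₀…bⱼ), A maps it into span(b₀…bⱼ₊₁), and E*ᵢ kills b₀…bᵢ₋₁.
      E*AE*-below≈0 : ∀ i j → suc (toℕ j) < toℕ i → ((Es i *ₘ A) *ₘ Es j) ≈ₘ 0ₘ
      E*AE*-below≈0 i j j+1<i = ·≈0ᵥ⇒≈0ₘ λ v → ≈ᵥ-trans (*ₘ-·₃ (Es i) A (Es j) v)
          (≈ᵥ-trans (·-cong {Es i} (λ _ _ → refl) (≈ᵥ-trans (·-cong {A} (λ _ _ → refl) (expansion (Es j · v))) (Represents-· Lθ A b A-rep (a v))))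
          (≈ᵥ-trans (·-lincomb (Es i) (λ m → (Lθ · a v) m) b) (lincomb-zero (λ m → (Lθ · a v) m) (λ m → Es i · b m) (vanishing v))))
        where
        a : Vec → Fin n → Carrier
        a v = coord (Es j · v)
        vanishing : ∀ v m → ((Lθ · a v) m ≈ 0#) ⊎ ((Es i · b m) ≈ᵥ 0ᵥ)
        vanishing v m with toℕ m <? toℕ i
        ... | yes m<i = inj₂ (E*-basis-below≈0 i m m<i)
        ... | no m≮i = inj₁ (lowerBidiag-·-above≈0 θ (a v) (toℕ j)
                (A*-eigen-coords-above≈0 j (Es j · v) (PI*.E-·-eigen j v)) m (ℕP.<-≤-trans j+1<i (ℕP.≮⇒≥ m≮i)))

      EA*E-above≈0 : ∀ i j → suc (toℕ i) < toℕ j → ((E i *ₘ As) *ₘ E j) ≈ₘ 0ₘ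
      EA*E-above≈0 i j i+1<j = ·≈0ᵥ⇒≈0ₘ λ v → ≈ᵥ-trans (*ₘ-·₃ (E i) As (E j) v)
          (≈ᵥ-trans (·-cong {E i} (λ _ _ → refl) (≈ᵥ-trans (·-cong {As} (λ _ _ → refl) (expansion (E j · v))) (Represents-· Uφ As b A*-rep (a v))))
          (≈ᵥ-trans (·-lincomb (E i) (λ m → (Uφ · a v) m) b) (lincomb-zero (λ m → (Uφ · a v) m) (λ m → E i · b m) (vanishing v))))
        where
        a : Vec → Fin n → Carrier
        a v = coord (E j · v)
        vanishing : ∀ v m → ((Uφ · a v) m ≈ 0#) ⊎ ((E i · b m) ≈ᵥ 0ᵥ)
        vanishing v m with toℕ i <? toℕ m
        ... | yes i<m = inj₂ (E-basis-above≈0 i m i<m)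
        ... | no i≮m = inj₁ (upperBidiag-·-below≈0 θs φ (a v) (toℕ j)
                (A-eigen-coords-below≈0 j (E j · v) (PI.E-·-eigen j v)) m (ℕP.≤-<-trans (s≤s (ℕP.≮⇒≥ i≮m)) i+1<j))

      private
        f : Fin n → Fin n → Carrier
        f j = coord (PI*.eigvec j)

        f-above≈0 : ∀ j k → j Fin.< k → f j k ≈ 0#
        f-above≈0 j = A*-eigen-coords-above≈0 j (PI*.eigvec j) (PI*.eigvec-eigen j)

      E*-·-basis-upTo : ∀ j (a : Fin n → Carrier) → (∀ k → j Fin.< k → a k ≈ 0#) →
                        (Es j · vsum (λ k → a k • b k)) ≈ᵥ (a j • (Es j · b j))
      E*-·-basis-upTo j a a-above≈0 = ≈ᵥ-trans (·-lincomb (Es j) a b) (vsum-single (λ k → a k • (Es j · b k)) j offDiagonal)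
        where
        offDiagonal : ∀ k → k ≢ j → (a k • (Es j · b k)) ≈ᵥ 0ᵥ
        offDiagonal k k≢j with ℕP.<-cmp (toℕ k) (toℕ j)
        ... | tri< k<j _ _ = ≈ᵥ-trans (•-cong {a k} refl (E*-basis-below≈0 j k k<j)) (•-0ᵥ _)
        ... | tri≈ _ e _ = ⊥-elim (k≢j (toℕ-injective e))
        ... | tri> _ _ j<k = ≈ᵥ-trans (•-cong {v = Es j · b k} (a-above≈0 k j<k) ≈ᵥ-refl) (0#-• _)

      E*-eigvec* : ∀ j → PI*.eigvec j ≈ᵥ (f j j • (Es j · b j))
      E*-eigvec* j = ≈ᵥ-trans (≈ᵥ-sym (PI*.E-eigvec j))
        (≈ᵥ-trans (·-cong {Es j} (λ _ _ → refl) (expansion (PI*.eigvec j))) (E*-·-basis-upTo j (f j) (f-above≈0 j)))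

      -- For i = j + 1, E*ᵢ A E*ⱼ sends the θ*ⱼ-eigenvector to (its bⱼ-coordinate) · E*ᵢ bᵢ, both nonzero.
      E*AE*-sub≉0 : ∀ i j → toℕ i ≡ suc (toℕ j) → ¬ (((Es i *ₘ A) *ₘ Es j) ≈ₘ 0ₘ)
      E*AE*-sub≉0 i j i≡j+1 E*AE*≈0 = E*-basis≉0 i (•≈0ᵥ⇒≈0ᵥ (f-diag≉0 j) fⱼ•E*bᵢ≈0)
        where
        f-diag≉0 : ∀ j → f j j ≉ 0#
        f-diag≉0 j e = PI*.eigvec≉0 j (≈ᵥ-trans (E*-eigvec* j) (≈ᵥ-trans (•-cong {v = Es j · b j} e ≈ᵥ-refl) (0#-• _)))
        E*-basis≉0 : ∀ i → ¬ ((Es i · b i) ≈ᵥ 0ᵥ)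
        E*-basis≉0 i e = PI*.eigvec≉0 i (≈ᵥ-trans (E*-eigvec* i) (≈ᵥ-trans (•-cong {f i i} refl e) (•-0ᵥ _)))
        L·fⱼ-at-i : (Lθ · f j) i ≈ f j j
        L·fⱼ-at-i = trans (sumF-single {n} (λ k → Lθ i k * f j k) j offDiagonal)
                          (trans (*-cong (lowerBidiag-sub θ i j i≡j+1) refl) (*-identityˡ _))
          where
          offDiagonal : ∀ k → k ≢ j → Lθ i k * f j k ≈ 0#
          offDiagonal k k≢j with ℕP.<-cmp (toℕ k) (toℕ j)
          ... | tri< k<j _ _ = trans (*-cong (lowerBidiag-zero θ i k (λ e → ℕP.<-irrefl (P.cong toℕ (P.sym e)) (ℕP.<-trans k<j (ℕP.≤-reflexive (P.sym i≡j+1))))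
                                        (λ e → ℕP.<-irrefl (P.trans (P.sym e) i≡j+1) (s≤s k<j))) refl) (zeroˡ _)
          ... | tri≈ _ e _ = ⊥-elim (k≢j (toℕ-injective e))
          ... | tri> _ _ j<k = trans (*-cong refl (f-above≈0 j k j<k)) (zeroʳ _)
        E*A-eigvec* : (Es i · (A · PI*.eigvec j)) ≈ᵥ ((Lθ · f j) i • (Es i · b i))
        E*A-eigvec* = ≈ᵥ-trans (·-cong {Es i} (λ _ _ → refl)
            (≈ᵥ-trans (·-cong {A} (λ _ _ → refl) (expansion (PI*.eigvec j))) (Represents-· Lθ A b A-rep (f j))))
          (≈ᵥ-trans (·-lincomb (Es i) (λ m → (Lθ · f j) m) b) (vsum-single (λ m → (Lθ · f j) m • (Es i · b m)) i offDiagonal))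
          where
          offDiagonal : ∀ m → m ≢ i → ((Lθ · f j) m • (Es i · b m)) ≈ᵥ 0ᵥ
          offDiagonal m m≢i with ℕP.<-cmp (toℕ m) (toℕ i)
          ... | tri< m<i _ _ = ≈ᵥ-trans (•-cong {(Lθ · f j) m} refl (E*-basis-below≈0 i m m<i)) (•-0ᵥ _)
          ... | tri≈ _ e _ = ⊥-elim (m≢i (toℕ-injective e))
          ... | tri> _ _ i<m = ≈ᵥ-trans (•-cong {v = Es i · b m}
                  (lowerBidiag-·-above≈0 θ (f j) (toℕ j) (f-above≈0 j) m (P.subst (_< toℕ m) i≡j+1 i<m)) ≈ᵥ-refl) (0#-• _)
        fⱼ•E*bᵢ≈0 : (f j j • (Es i · b i)) ≈ᵥ 0ᵥ
        fⱼ•E*bᵢ≈0 = ≈ᵥ-trans (•-cong {v = Es i · b i} (sym L·fⱼ-at-i) ≈ᵥ-refl) (≈ᵥ-trans (≈ᵥ-sym E*A-eigvec*)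
          (≈ᵥ-trans (·-cong {Es i} (λ _ _ → refl) (·-cong {A} (λ _ _ → refl) (≈ᵥ-sym (PI*.E-eigvec j))))
          (≈ᵥ-trans (≈ᵥ-sym (*ₘ-·₃ (Es i) A (Es j) (PI*.eigvec j))) (≈0ₘ⇒·≈0ᵥ E*AE*≈0 (PI*.eigvec j)))))

      condI : CondI A E As Es
      condI = E*AE*-below≈0 , E*AE*-sub≉0 , EA*E-above≈0


    ξ : Vec
    ξ = PI*.eigvec zero
    τξ : Fin n → Vec
    τξ i = tau θ A i · ξ

    -- In the A*-eigenbasis, (i) makes A lower Hessenberg with nonzero subdiagonal, so τᵢ(A)ξ has
    -- leading coordinate i; the τᵢ(A)ξ therefore form a basis.  (A* − θ*ᵢ₊₁)τᵢ₊₁(A)ξ has vanishing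
    -- A*-coordinates from i + 1 on and, by E A* E = 0 above the superdiagonal, vanishing
    -- A-coordinates below i, which pins it to a multiple of τᵢ(A)ξ.
    module FromCondI (condI : CondI A E As Es) where
      private
        E*AE*-below≈0 : ∀ i j → suc (toℕ j) < toℕ i → ((Es i *ₘ A) *ₘ Es j) ≈ₘ 0ₘ
        E*AE*-below≈0 = proj₁ condI
        E*AE*-sub≉0 : ∀ i j → toℕ i ≡ suc (toℕ j) → ¬ (((Es i *ₘ A) *ₘ Es j) ≈ₘ 0ₘ)
        E*AE*-sub≉0 = proj₁ (proj₂ condI)
        EA*E-above≈0 : ∀ i j → suc (toℕ i) < toℕ j → ((E i *ₘ As) *ₘ E j) ≈ₘ 0ₘ
        EA*E-above≈0 = proj₂ (proj₂ condI)

      A-eigvec*-above≈0 : ∀ j k → suc (toℕ j) < toℕ k → PI*.coord (A · PI*.eigvec j) k ≈ 0#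
      A-eigvec*-above≈0 j k j+1<k = PI*.E·≈0⇒coord≈0 k (A · PI*.eigvec j)
        (≈ᵥ-trans (·-cong {Es k} (λ _ _ → refl) (·-cong {A} (λ _ _ → refl) (≈ᵥ-sym (PI*.E-eigvec j))))
        (≈ᵥ-trans (≈ᵥ-sym (*ₘ-·₃ (Es k) A (Es j) (PI*.eigvec j))) (≈0ₘ⇒·≈0ᵥ (E*AE*-below≈0 k j j+1<k) (PI*.eigvec j))))

      A-eigvec*-sub≉0 : ∀ (i : Fin d) → PI*.coord (A · PI*.eigvec (inject₁ i)) (suc i) ≉ 0#
      A-eigvec*-sub≉0 i coord≈0 = E*AE*-sub≉0 (suc i) (inject₁ i) (P.cong suc (P.sym (toℕ-inject₁ i))) (·≈0ᵥ⇒≈0ₘ vanishes)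
        where
        vanishes : ∀ v → (((Es (suc i) *ₘ A) *ₘ Es (inject₁ i)) · v) ≈ᵥ 0ᵥ
        vanishes v = ≈ᵥ-trans (*ₘ-·₃ (Es (suc i)) A (Es (inject₁ i)) v)
          (≈ᵥ-trans (·-cong {Es (suc i)} (λ _ _ → refl) (≈ᵥ-trans (·-cong {A} (λ _ _ → refl) (PI*.E-·-coord (inject₁ i) v)) (·-• A x f)))
          (≈ᵥ-trans (·-• (Es (suc i)) x (A · f)) (≈ᵥ-trans (•-cong {x} refl (PI*.E-·-coord (suc i) (A · f)))
          (≈ᵥ-trans (•-cong {x} refl (≈ᵥ-trans (•-cong {v = PI*.eigvec (suc i)} coord≈0 ≈ᵥ-refl) (0#-• _))) (•-0ᵥ x)))))
          where
          x : Carrier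
          x = PI*.coord v (inject₁ i)
          f : Vec
          f = PI*.eigvec (inject₁ i)

      LeadingCoord : Fin n → Set ℓ
      LeadingCoord i = (∀ k → i Fin.< k → PI*.coord (τξ i) k ≈ 0#) × PI*.coord (τξ i) i ≉ 0#

      τξ-leading : ∀ i → LeadingCoord i
      τξ-leading = <-rec LeadingCoord step
        where
        step : ∀ m → (∀ t → t Fin.< m → LeadingCoord t) → LeadingCoord m
        step zero _ = (λ k 0<k → trans (PI*.coord-cong (tau-zero θ A ξ) k)
                                   (trans (PI*.coord-basis zero k) (Iₘ-offDiag k zero (λ e → ℕP.<-irrefl (P.cong toℕ (P.sym e)) 0<k))))
                    , ≉0-resp-≈ (sym (trans (PI*.coord-cong (tau-zero θ A ξ) zero) (trans (PI*.coord-basis zero zero) (Iₘ-diag zero)))) 1≉0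
        step (suc i) IH = above≈0 , ≉0-resp-≈ (sym (trans (coord-next (suc i)) (trans (+-cong diagonal-term
            (-‿cong (trans (*-cong refl (proj₁ previous (suc i) (inject₁<suc i))) (zeroʳ _)))) (x≈y⇒x∙y⁻¹≈ε′ _))))
            (*-preserves-≉0 (proj₂ previous) (A-eigvec*-sub≉0 i))
          where
          x≈y⇒x∙y⁻¹≈ε′ : ∀ x → x - 0# ≈ x
          x≈y⇒x∙y⁻¹≈ε′ x = trans (+-cong refl -0#≈0#) (+-identityʳ x)
          previous : LeadingCoord (inject₁ i)
          previous = IH (inject₁ i) (inject₁<suc i)
          cᵢ : Fin n → Carrier
          cᵢ = PI*.coord (τξ (inject₁ i))
          coord-next : ∀ k → PI*.coord (τξ (suc i)) k ≈ sumF (λ l → cᵢ l * PI*.coord (A · PI*.eigvec l) k) - θ (inject₁ i) * cᵢ k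
          coord-next k = trans (PI*.coord-cong (tau-suc θ A i ξ) k)
            (trans (PI*.coord-shift· A (θ (inject₁ i)) (τξ (inject₁ i)) k) (+-cong (PI*.coord-· A (τξ (inject₁ i)) k) refl))
          above≈0 : ∀ k → suc i Fin.< k → PI*.coord (τξ (suc i)) k ≈ 0#
          above≈0 k i+1<k = trans (coord-next k) (x≈0∧y≈0⇒x-y≈0
            (sumF-zero {n} (λ l → cᵢ l * PI*.coord (A · PI*.eigvec l) k) (λ l → caseDec (toℕ (inject₁ i) <? toℕ l)
              (λ i<l → trans (*-cong (proj₁ previous l i<l) refl) (zeroˡ _))
              (λ i≮l → trans (*-cong refl (A-eigvec*-above≈0 l k
                (ℕP.≤-<-trans (s≤s (ℕP.≤-trans (ℕP.≮⇒≥ i≮l) (ℕP.≤-reflexive (toℕ-inject₁ i)))) i+1<k))) (zeroʳ _))))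
            (trans (*-cong refl (proj₁ previous k (ℕP.<-trans (inject₁<suc i) i+1<k))) (zeroʳ _)))
          diagonal-term : sumF (λ l → cᵢ l * PI*.coord (A · PI*.eigvec l) (suc i)) ≈ cᵢ (inject₁ i) * PI*.coord (A · PI*.eigvec (inject₁ i)) (suc i)
          diagonal-term = sumF-single {n} (λ l → cᵢ l * PI*.coord (A · PI*.eigvec l) (suc i)) (inject₁ i) λ l l≢i → caseTri (toℕ l) (toℕ (inject₁ i))
            (λ l<i → trans (*-cong refl (A-eigvec*-above≈0 l (suc i) (s≤s (P.subst (toℕ l <_) (toℕ-inject₁ i) l<i)))) (zeroʳ _))
            (λ e → ⊥-elim (l≢i (toℕ-injective e)))
            (λ i<l → trans (*-cong (proj₁ previous l i<l) refl) (zeroˡ _))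

      τξ≉0 : ∀ i → ¬ (τξ i ≈ᵥ 0ᵥ)
      τξ≉0 i e = proj₂ (τξ-leading i) (trans (PI*.coord-cong e i) (PI*.coord-0ᵥ i))

      τξ-basis : IsBasis τξ
      τξ-basis = direct⇒isBasis τξ τξ≉0 λ a h i → ≈ᵥ-trans (•-cong {v = τξ i} (independent a h i) ≈ᵥ-refl) (0#-• _)
        where
        independent : ∀ (a : Fin n → Carrier) → vsum (λ i → a i • τξ i) ≈ᵥ 0ᵥ → ∀ i → a i ≈ 0#
        independent a h i = Downward.combination≈0 (λ _ → ⊤) (λ _ _ _ _ → tt) (λ t m → PI*.coord (τξ t) m)
          (λ m t t≢m m≮t → proj₁ (τξ-leading t) m (ℕP.≤∧≢⇒< (ℕP.≮⇒≥ m≮t) (λ e → t≢m (toℕ-injective e)))) (λ m → proj₂ (τξ-leading m))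
          a (λ _ → 0#) (λ m → trans (sym (trans (PI*.coord-cong h m) (PI*.coord-0ᵥ m))) (PI*.coord-lincomb a τξ m)) (λ _ _ → refl) i tt

      module TB = Basis τξ τξ-basis

      coord-ξ≉0 : ∀ k → PI.coord ξ k ≉ 0#
      coord-ξ≉0 k coord≈0 = PI.eigvec≉0 k (≈ᵥ-trans (≈ᵥ-sym (PI.E-eigvec k)) (Eₖ≈0 (PI.eigvec k)))
        where
        Eₖξ≈0 : (E k · ξ) ≈ᵥ 0ᵥ
        Eₖξ≈0 = ≈ᵥ-trans (PI.E-·-coord k ξ) (≈ᵥ-trans (•-cong {v = PI.eigvec k} coord≈0 ≈ᵥ-refl) (0#-• _))
        Eₖ≈0 : ∀ v → (E k · v) ≈ᵥ 0ᵥ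
        Eₖ≈0 v = ≈ᵥ-trans (·-cong {E k} (λ _ _ → refl) (TB.expansion v))
          (≈ᵥ-trans (·-lincomb (E k) (TB.coord v) τξ) (vsum-zero (λ l → TB.coord v l • (E k · τξ l)) λ l →
            ≈ᵥ-trans (•-cong {TB.coord v l} refl (≈ᵥ-trans (PI.E-·-tau k l ξ) (≈ᵥ-trans (•-cong {PI.τθ l k} refl Eₖξ≈0) (•-0ᵥ _)))) (•-0ᵥ _)))

      coord-τξ : ∀ i m → PI.coord (τξ i) m ≈ PI.τθ i m * PI.coord ξ m
      coord-τξ i m = PI.E-·≈•E-·⇒coord≈ m {τξ i} {ξ} (PI.E-·-tau m i ξ)

      coord-τξ-below≈0 : ∀ i m → m Fin.< i → PI.coord (τξ i) m ≈ 0#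
      coord-τξ-below≈0 i m m<i = trans (coord-τξ i m) (trans (*-cong (PI.τθ-below≈0 i m m<i) refl) (zeroˡ _))

      coord-τξ-diag≉0 : ∀ i → PI.coord (τξ i) i ≉ 0#
      coord-τξ-diag≉0 i = ≉0-resp-≈ (sym (coord-τξ i i)) (*-preserves-≉0 (PI.τθ≉0 i i ℕP.≤-refl) (coord-ξ≉0 i))

      lowered : Fin d → Vec
      lowered i = shift As (θs (suc i)) · τξ (suc i)

      coord*-lowered-above≈0 : ∀ i k → toℕ (suc i) ≤ toℕ k → PI*.coord (lowered i) k ≈ 0#
      coord*-lowered-above≈0 i k i+1≤k = trans (PI*.coord-shift· As (θs (suc i)) (τξ (suc i)) k)
          (trans (+-cong (PI*.coord-X (τξ (suc i)) k) refl) (caseTri {X = θs k * PI*.coord (τξ (suc i)) k - θs (suc i) * PI*.coord (τξ (suc i)) k ≈ 0#} (toℕ (suc i)) (toℕ k)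
            (λ i+1<k → x≈0∧y≈0⇒x-y≈0 (trans (*-cong refl (proj₁ (τξ-leading (suc i)) k i+1<k)) (zeroʳ _))
                                     (trans (*-cong refl (proj₁ (τξ-leading (suc i)) k i+1<k)) (zeroʳ _)))
            (λ e → trans (+-cong (*-cong (reflexive (P.cong θs (toℕ-injective (P.sym e)))) refl) refl) (-‿inverseʳ _))
            (λ k<i+1 → ⊥-elim (ℕP.<-irrefl P.refl (ℕP.<-≤-trans k<i+1 i+1≤k)))))

      A*-eigvec-below≈0 : ∀ l m → suc (toℕ m) < toℕ l → PI.coord (As · PI.eigvec l) m ≈ 0#
      A*-eigvec-below≈0 l m m+1<l = PI.E·≈0⇒coord≈0 m (As · PI.eigvec l)
        (≈ᵥ-trans (·-cong {E m} (λ _ _ → refl) (·-cong {As} (λ _ _ → refl) (≈ᵥ-sym (PI.E-eigvec l))))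
        (≈ᵥ-trans (≈ᵥ-sym (*ₘ-·₃ (E m) As (E l) (PI.eigvec l))) (≈0ₘ⇒·≈0ᵥ (EA*E-above≈0 m l m+1<l) (PI.eigvec l))))

      coord-lowered-below≈0 : ∀ i m → m Fin.< inject₁ i → PI.coord (lowered i) m ≈ 0#
      coord-lowered-below≈0 i m m<i = trans (PI.coord-shift· As (θs (suc i)) (τξ (suc i)) m) (x≈0∧y≈0⇒x-y≈0
          (trans (PI.coord-· As (τξ (suc i)) m) (sumF-zero {n} (λ l → PI.coord (τξ (suc i)) l * PI.coord (As · PI.eigvec l) m) λ l → caseDec (toℕ l <? toℕ (suc i))
            (λ l<i+1 → trans (*-cong (coord-τξ-below≈0 (suc i) l l<i+1) refl) (zeroˡ _))
            (λ l≮i+1 → trans (*-cong refl (A*-eigvec-below≈0 l m (ℕP.<-≤-trans (s≤s m<i′) (ℕP.≮⇒≥ l≮i+1)))) (zeroʳ _))))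
          (trans (*-cong refl (coord-τξ-below≈0 (suc i) m (ℕP.<-trans m<i′ ℕP.≤-refl))) (zeroʳ _)))
        where
        m<i′ : toℕ m < toℕ i
        m<i′ = P.subst (toℕ m <_) (toℕ-inject₁ i) m<i

      lowered≈•τξ : ∀ i → lowered i ≈ᵥ (TB.coord (lowered i) (inject₁ i) • τξ (inject₁ i))
      lowered≈•τξ i = ≈ᵥ-trans (TB.expansion (lowered i)) (vsum-single _ (inject₁ i) λ t t≢i →
          ≈ᵥ-trans (•-cong {v = τξ t} (caseTri {X = β t ≈ 0#} (toℕ t) (toℕ (inject₁ i)) (below t) (λ e → ⊥-elim (t≢i (toℕ-injective e))) (above t)) ≈ᵥ-refl) (0#-• _))
        where
        β : Fin n → Carrier
        β = TB.coord (lowered i)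
        above : ∀ t → inject₁ i Fin.< t → β t ≈ 0#
        above = Downward.combination≈0 (λ t → inject₁ i Fin.< t) (λ m t i<m m<t → ℕP.<-trans i<m m<t) (λ t m → PI*.coord (τξ t) m)
          (λ m t t≢m m≮t → proj₁ (τξ-leading t) m (ℕP.≤∧≢⇒< (ℕP.≮⇒≥ m≮t) (λ e → t≢m (toℕ-injective e)))) (λ m → proj₂ (τξ-leading m))
          β (PI*.coord (lowered i)) (λ m → trans (PI*.coord-cong (TB.expansion (lowered i)) m) (PI*.coord-lincomb β τξ m))
          (λ m i<m → coord*-lowered-above≈0 i m (P.subst (_≤ toℕ m) (P.cong suc (toℕ-inject₁ i)) i<m))
        below : ∀ t → t Fin.< inject₁ i → β t ≈ 0#
        below = Upward.combination≈0 (λ t → t Fin.< inject₁ i) (λ m t m<i t<m → ℕP.<-trans t<m m<i) (λ t m → PI.coord (τξ t) m)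
          (λ m t t≢m t≮m → coord-τξ-below≈0 t m (ℕP.≤∧≢⇒< (ℕP.≮⇒≥ t≮m) (λ e → t≢m (toℕ-injective (P.sym e))))) coord-τξ-diag≉0
          β (PI.coord (lowered i)) (λ m → trans (PI.coord-cong (TB.expansion (lowered i)) m) (PI.coord-lincomb β τξ m))
          (coord-lowered-below≈0 i)

      A-τξ-last≈0 : (shift A (θ (fromℕ d)) · τξ (fromℕ d)) ≈ᵥ 0ᵥ
      A-τξ-last≈0 = ≈ᵥ-trans (≈ᵥ-sym (tauGen-suc θ A (fromℕ d) ξ)) (PI.tauGen-last≈0 ξ)

      A*-τξ₀≈0 : (shift As (θs zero) · τξ zero) ≈ᵥ 0ᵥ
      A*-τξ₀≈0 = ≈ᵥ-trans (·-cong {shift As (θs zero)} (λ _ _ → refl) (tau-zero θ A ξ))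
        (≈ᵥ-trans (shift-·-eigen {As} {θs zero} {ξ} (θs zero) (PI*.eigvec-eigen zero)) (≈ᵥ-trans (•-cong {v = ξ} (-‿inverseʳ _) ≈ᵥ-refl) (0#-• _)))

      condII : CondII A As θ θs
      condII = (λ i → span1 (τξ i)) , TB.decomposition
        , (λ i → Image-span1 {shift A (θ (inject₁ i))} {τξ (inject₁ i)} {τξ (suc i)} (≈ᵥ-sym (tau-suc θ A i ξ)))
        , Image-span1-zero {shift A (θ (fromℕ d))} {τξ (fromℕ d)} A-τξ-last≈0
        , (λ i → Image-span1-⊆ {shift As (θs (suc i))} {τξ (suc i)} {τξ (inject₁ i)} (lowered≈•τξ i))
        , Image-span1-zero {shift As (θs zero)} {τξ zero} A*-τξ₀≈0

    τ-·-θ*₀-eigen : ∀ v → InEigenspace As (θs zero) v → ∀ i → (tau θ A i · v) ≈ᵥ (PI*.coord v zero • τξ i)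
    τ-·-θ*₀-eigen v v-eigen i = ≈ᵥ-trans (·-cong {tau θ A i} (λ _ _ → refl) (PI*.eigen⇒≈coord•eigvec zero v v-eigen))
                                         (·-• (tau θ A i) _ ξ)

    decomposition≐span-τξ : ∀ U → IsDecomposition U → CondIIFor A As θ θs U → ∀ i → U i ≐ span1 (τξ i)
    decomposition≐span-τξ U decomposition condII i =
      ≐-trans (D.U≐span-b i) (span1-•-≉0 (PI*.coord D.g₀ zero) s≉0 (τ-·-θ*₀-eigen D.g₀ D.g₀-eigen i))
      where
      module D = FromDecomposition A As θ θs U decomposition condII
      s≉0 : PI*.coord D.g₀ zero ≉ 0#
      s≉0 = •-≉0ᵥ⇒≉0 (PI*.eigen⇒≈coord•eigvec zero D.g₀ D.g₀-eigen) (D.g≉0 zero)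

    Range-τE*₀≐span-τξ : ∀ i → Range (tau θ A i *ₘ Es zero) ≐ span1 (τξ i)
    Range-τE*₀≐span-τξ i = range⊆span , span⊆range
      where
      T : Mat
      T = tau θ A i
      range⊆span : Range (T *ₘ Es zero) ⊆ span1 (τξ i)
      range⊆span w (v , w≈) = PI*.coord v zero , ≈ᵥ-trans w≈ (≈ᵥ-trans (*ₘ-· T (Es zero) v)
        (≈ᵥ-trans (·-cong {T} (λ _ _ → refl) (PI*.E-·-coord zero v)) (·-• T _ ξ)))
      span⊆range : span1 (τξ i) ⊆ Range (T *ₘ Es zero)
      span⊆range w (x , w≈) = (x • ξ) , ≈ᵥ-trans w≈ (≈ᵥ-sym (≈ᵥ-trans (*ₘ-· T (Es zero) (x • ξ))
        (≈ᵥ-trans (·-cong {T} (λ _ _ → refl) (≈ᵥ-trans (·-• (Es zero) x ξ) (•-cong {x} refl (PI*.E-eigvec zero))))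
                  (·-• T x ξ))))

    module BidiagonalBasis (φ : Fin d → Carrier) (b : Fin n → Vec) (condIII : CondIIIFor A As θ θs φ b) where
      open Basis b (proj₁ condIII) public using (basis≉0; •-basis≈0⇒≈0)

      b₀-eigen : InEigenspace As (θs zero) (b zero)
      b₀-eigen = Represents-upperBidiag⇒₀ {As} {θs} {φ} {b} (proj₂ (proj₂ condIII))

      b≈τ : ∀ i → b i ≈ᵥ (tau θ A i · b zero)
      b≈τ = Represents-lowerBidiag⇒tau {A} {θ} {b} (proj₁ (proj₂ condIII))

      s : Carrier
      s = PI*.coord (b zero) zero

      b≈•τξ : ∀ i → b i ≈ᵥ (s • τξ i)
      b≈•τξ i = ≈ᵥ-trans (b≈τ i) (τ-·-θ*₀-eigen (b zero) b₀-eigen i)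

      s≉0 : s ≉ 0#
      s≉0 = •-≉0ᵥ⇒≉0 (b≈•τξ zero) (basis≉0 zero)

      b₀∈E*₀V : Range (Es zero) (b zero)
      b₀∈E*₀V = b zero , ≈ᵥ-trans (PI*.eigen⇒≈coord•eigvec zero (b zero) b₀-eigen) (≈ᵥ-sym (PI*.E-·-coord zero (b zero)))

      A*-τξ : ∀ k → (shift As (θs (suc k)) · τξ (suc k)) ≈ᵥ (φ k • τξ (inject₁ k))
      A*-τξ k = •-cancel s≉0 (≈ᵥ-trans (≈ᵥ-sym (·-• (shift As (θs (suc k))) s (τξ (suc k))))
        (≈ᵥ-trans (·-cong {shift As (θs (suc k))} (λ _ _ → refl) (≈ᵥ-sym (b≈•τξ (suc k))))
        (≈ᵥ-trans (Represents-upperBidiag⇒ {As} {θs} {φ} {b} (proj₂ (proj₂ condIII)) k)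
        (≈ᵥ-trans (•-cong {φ k} refl (b≈•τξ (inject₁ k))) (λ r → *-CS.x∙yz≈y∙xz (φ k) s _)))))

    basis-generated-by-E*₀V : ∀ φ b → CondIIIFor A As θ θs φ b →
      Σ Vec (λ ξ' → ¬ (ξ' ≈ᵥ 0ᵥ) × Range (Es zero) ξ' × (∀ i → b i ≈ᵥ (tau θ A i · ξ'))
                  × (∀ U → IsDecomposition U → CondIIFor A As θ θs U → ∀ i → span1 (b i) ≐ U i))
    basis-generated-by-E*₀V φ b condIII = b zero , basis≉0 zero , b₀∈E*₀V , b≈τ ,
      λ U decomposition condII i → ≐-trans (span1-•-≉0 s s≉0 (b≈•τξ i)) (≐-sym (decomposition≐span-τξ U decomposition condII i))
      where open BidiagonalBasis φ b condIII

    -- Both φ and φ' are read off from (A* − θ*ₖ₊₁) τξₖ₊₁ = φₖ τξₖ; the basis b separates them.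
    φ-unique : ∀ φ b φ' b' → CondIIIFor A As θ θs φ b → CondIIIFor A As θ θs φ' b' → ∀ k → φ k ≈ φ' k
    φ-unique φ b φ' b' condIII condIII' k = x∙y⁻¹≈ε⇒x≈y _ _ (•-basis≈0⇒≈0 (inject₁ k) (φ k - φ' k)
        (≈ᵥ-trans (•-cong {φ k - φ' k} refl (b≈•τξ (inject₁ k)))
        (≈ᵥ-trans (λ r → *-CS.x∙yz≈y∙xz (φ k - φ' k) s _) (≈ᵥ-trans (•-cong {s} refl Δφ•τξ≈0) (•-0ᵥ s)))))
      where
      open BidiagonalBasis φ b condIII
      Δφ•τξ≈0 : ((φ k - φ' k) • τξ (inject₁ k)) ≈ᵥ 0ᵥ
      Δφ•τξ≈0 = ≈ᵥ-trans (λ r → trans (distribʳ _ _ _) (+-cong refl (sym (-‿distribˡ-* _ _))))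
        (u≈v⇒u-v≈0 (≈ᵥ-trans (≈ᵥ-sym (A*-τξ k)) (BidiagonalBasis.A*-τξ φ' b' condIII' k)))

    E*₀-normalizing : CondI A E As Es → ∀ i → ¬ ((E i *ₘ Es zero) ≈ₘ 0ₘ)
    E*₀-normalizing condI i EᵢE*₀≈0 = FromCondI.coord-ξ≉0 condI i (PI.E·≈0⇒coord≈0 i ξ
      (≈ᵥ-trans (·-cong {E i} (λ _ _ → refl) (≈ᵥ-sym (PI*.E-eigvec zero)))
      (≈ᵥ-trans (≈ᵥ-sym (*ₘ-· (E i) (Es zero) ξ)) (≈0ₘ⇒·≈0ᵥ EᵢE*₀≈0 ξ))))

    moreover : CondI A E As Es → Moreover A E As Es θ θs
    moreover condI = E*₀-normalizing condI
      , (λ U decomposition condII i → ≐-trans (decomposition≐span-τξ U decomposition condII i) (≐-sym (Range-τE*₀≐span-τξ i)))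
      , basis-generated-by-E*₀V
      , φ-unique

proposition7p6 : ∀ {c ℓ : Level} (F : Field c ℓ) (d : ℕ) → LinAlg.Proposition7p6 F d
proposition7p6 F d A E As Es θ θs PL =
    PreLeonard.FromCondI.condII F d A E As Es θ θs PL
  , ii⇒iii F d A As θ θs
  , (λ { (φ , b , condIII) → PreLeonard.FromBidiagonalBasis.condI F d A E As Es θ θs PL φ b condIII })
  , (λ condI _ _ → PreLeonard.moreover F d A E As Es θ θs PL condI)
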